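{- Let $f(x),g(x)\in\mathbb{Q}[x]$ be non-constant, both having only simple rational roots, with $\deg(f)\le\deg(g)$. Suppose the equation $f(x)=g(y)$ has infinitely many rational solutions with a bounded denominator, and that $f=\varphi(F(\kappa))$, $g=\varphi(G(\lambda))$ where $\kappa,\lambda\in\mathbb{Q}[x]$ are linear, $\varphi\in\mathbb{Q}[x]$, and $(F,G)$ is a standard pair over $\mathbb{Q}$ of the first or second kind such that $F(x)=G(y)$ has infinitely many rational solutions with a bounded denominator. Then, after replacing $f,g$ by similar polynomials $\tilde f(x)=f(ax+b)$, $\tilde g(y)=g(cy+d)$ for suitable $a,b,c,d\in\mathbb{Q}$ with $ac\neq0$, one of the following holds: 1. $\deg(f)\mid\deg(g)$, and there exist $G_0\in\mathbb{Q}[y]$ of degree $n\ge1$, $p_0\in\mathbb{Q}\setminus\{0\}$ and distinct $p_1,\dots,p_s\in\mathbb{Q}$ such that $\tilde f(x)=p_0\prod_{i=1}^s(x-p_i)$, $\tilde g(y)=p_0\prod_{i=1}^s(G_0(y)-p_i)$, the polynomials $G_0(y)-p_i$ $(i=1,\dots,s)$ form a $\mathrm{PTE}_n$ set, and for every $X\in\mathbb{Z}$ the pair $(x,y)=(G_0(X),X)$ is a solution of $\tilde f(x)=\tilde g(y)$. 2. $\deg(f)\mid 2\deg(g)$, and there exist $G_0\in\mathbb{Q}[y]$ of degree $n\ge1$, $q_0\in\mathbb{Q}\setminus\{0\}$ and distinct positive rationals $q_1,\dots,q_s$ such that $\tilde f(x)=q_0\prod_{i=1}^s(x-q_i)(x+q_i)$,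 $\tilde g(y)=q_0\prod_{i=1}^s(G_0(y)-q_i^2)$, $G_0$ has at most two (complex) roots of odd multiplicity, the polynomials $G_0(y)-q_i^2$ $(i=1,\dots,s)$ form a $\mathrm{PTE}_n$ set, the equation $x^2=G_0(y)$ has infinitely many rational solutions $(X_i,Y_i)$ $(i=1,2,\dots)$ with a bounded denominator, and these $(X_i,Y_i)$ are also solutions of $\tilde f(x)=\tilde g(y)$.
   Context: "Only simple rational roots" means all complex roots are rational and pairwise distinct. An equation $P(x)=Q(y)$ has infinitely many rational solutions with a bounded denominator if for some positive integer $\Delta$ there are infinitely many $(x,y)\in\mathbb{Q}^2$ with $P(x)=Q(y)$ and $(\Delta x,\Delta y)\in\mathbb{Z}^2$. $F,G\in\mathbb{Q}[x]$ form a standard pair of the first kind if $(F,G)$ or $(G,F)$ equals $(x^q,\alpha x^p v(x)^q)$ with $\alpha\in\mathbb{Q}\setminus\{0\}$, $q$ a positive integer, $0\le p<q$, $\gcd(p,q)=1$, $v\in\mathbb{Q}[x]$ nonzero, $p+\deg(v)>0$; of the second kind if $(F,G)$ or $(G,F)$ equals $(x^2,(\alpha x^2+\beta)v(x)^2)$ with $\alpha,\beta\in\mathbb{Q}\setminus\{0\}$ and $v\in\mathbb{Q}[x]$ nonzero. A $\mathrm{PTE}_n$ set is a finite set $\{F_1,\dots,F_s\}$ of polynomials in $\mathbb{Q}[x]$, each of degree $n$ and having only simple rational roots, such that $F_i-F_j$ is a nonzero rational constant for all $i\ne j$. -}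

module Defs where

open import Data.Nat as ℕ using (ℕ; zero; suc)
open import Data.Nat.Divisibility using (_∣_)
open import Data.Nat.GCD using (gcd)
open import Data.Integer as ℤ using (ℤ; +_)
open import Data.Rational as ℚ using (ℚ; 0ℚ; 1ℚ; _+_; _*_; _-_; _<_)
open import Data.Rational.Properties using (_≟_)
open import Data.Fin using (Fin)
import Data.Fin as F
open import Data.List using (List; []; _∷_)
open import Data.List.Membership.Propositional using (_∉_)
open import Data.Maybe using (Maybe; just; nothing)
open import Data.Product using (Σ; ∃; _×_; _,_)
open import Data.Sum using (_⊎_)
open import Function.Definitions using (Injective)
open import Relation.Nullary using (¬_; yes; no)
open import Relation.Binary.PropositionalEquality using (_≡_; _≢_)

-- Polynomials over ℚ as coefficient lists (constant term first).

Poly : Set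
Poly = List ℚ

eval : Poly → ℚ → ℚ
eval []       x = 0ℚ
eval (a ∷ as) x = a + x * eval as x

degM : Poly → Maybe ℕ
degM [] = nothing
degM (a ∷ as) with degM as
... | just d  = just (suc d)
... | nothing with a ≟ 0ℚ
...   | yes _ = nothing
...   | no  _ = just 0

IsZeroPoly : Poly → Set
IsZeroPoly p = degM p ≡ nothing

-- degree of a nonzero polynomial (the zero polynomial gets 0; it is
-- only used on nonzero polynomials below)
deg : Poly → ℕ
deg p with degM p
... | just d  = d
... | nothing = 0

infixr 8 _^_
_^_ : ℚ → ℕ → ℚ
x ^ zero  = 1ℚ
x ^ suc n = x * x ^ n

prod : (s : ℕ) → (Fin s → ℚ) → ℚ
prod zero    h = 1ℚ
prod (suc s) h = h F.zero * prod s (λ i → h (F.suc i))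

-- "only simple rational roots": f = c ∏ (x - r_i), c ≠ 0, r_i pairwise
-- distinct rationals (i.e. f splits over ℚ with all roots simple).

SimpleRationalRoots : Poly → Set
SimpleRationalRoots f =
  Σ ℚ λ c → c ≢ 0ℚ × Σ ℕ λ s → Σ (Fin s → ℚ) λ r →
    Injective _≡_ _≡_ r × (∀ x → eval f x ≡ c * prod s (λ i → x - r i))

ℚofℕ : ℕ → ℚ
ℚofℕ n = (+ n) ℚ./ 1

IsIntegerℚ : ℚ → Set
IsIntegerℚ q = ℚ.denominatorℕ q ≡ 1

-- a relation P ⊆ ℚ² has infinitely many solutions with a bounded
-- denominator: some positive integer Δ such that, for every finite list
-- of pairs, there is a solution (x,y) outside the list with Δx, Δy ∈ ℤ.
InfManyBoundedDenom : (ℚ → ℚ → Set) → Set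
InfManyBoundedDenom P =
  Σ ℕ λ Δ → Δ ≢ 0 ×
    ((L : List (ℚ × ℚ)) → Σ ℚ λ x → Σ ℚ λ y →
       P x y × IsIntegerℚ (ℚofℕ Δ * x) × IsIntegerℚ (ℚofℕ Δ * y)
       × (x , y) ∉ L)

EqSol : Poly → Poly → ℚ → ℚ → Set
EqSol P Q x y = eval P x ≡ eval Q y

-- Standard pairs (equalities of polynomials expressed pointwise on ℚ,
-- which is equivalent over the infinite field ℚ).

StdFirstOrdered : Poly → Poly → Set
StdFirstOrdered F G =
  Σ ℚ λ α → Σ ℕ λ q → Σ ℕ λ p → Σ Poly λ v →
    α ≢ 0ℚ × 1 ℕ.≤ q × p ℕ.< q × gcd p q ≡ 1 × ¬ IsZeroPoly v
    × 0 ℕ.< p ℕ.+ deg v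
    × (∀ x → eval F x ≡ x ^ q)
    × (∀ x → eval G x ≡ α * x ^ p * (eval v x) ^ q)

StdSecondOrdered : Poly → Poly → Set
StdSecondOrdered F G =
  Σ ℚ λ α → Σ ℚ λ β → Σ Poly λ v →
    α ≢ 0ℚ × β ≢ 0ℚ × ¬ IsZeroPoly v
    × (∀ x → eval F x ≡ x ^ 2)
    × (∀ x → eval G x ≡ (α * x ^ 2 + β) * (eval v x) ^ 2)

StandardPair1or2 : Poly → Poly → Set
StandardPair1or2 F G =
  StdFirstOrdered F G ⊎ StdFirstOrdered G F
  ⊎ StdSecondOrdered F G ⊎ StdSecondOrdered G F

PTE : ℕ → (s : ℕ) → (Fin s → Poly) → Set
PTE n s H =
  (∀ i → ¬ IsZeroPoly (H i) × deg (H i) ≡ n × SimpleRationalRoots (H i))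
  × (∀ i j → i ≢ j → Σ ℚ λ c → c ≢ 0ℚ × (∀ x → eval (H i) x - eval (H j) x ≡ c))

subConst : Poly → ℚ → Poly
subConst [] c = (0ℚ - c) ∷ []
subConst (a ∷ as) c = (a - c) ∷ as

-- "G0 has at most two (complex) roots of odd multiplicity", rendered
-- over ℚ: G0 = h · w² with h, w ∈ ℚ[y], deg h ≤ 2.

AtMostTwoOddRoots : Poly → Set
AtMostTwoOddRoots G0 =
  Σ Poly λ h → Σ Poly λ w → ¬ IsZeroPoly h × deg h ℕ.≤ 2
    × (∀ y → eval G0 y ≡ eval h y * (eval w y) ^ 2)

Case1 : ℕ → ℕ → (ℚ → ℚ) → (ℚ → ℚ) → Set
Case1 degf degg ft gt =
  degf ∣ degg ×
  (Σ Poly λ G0 → Σ ℕ λ n → Σ ℚ λ p0 → Σ ℕ λ s → Σ (Fin s → ℚ) λ p →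
     ¬ IsZeroPoly G0 × deg G0 ≡ n × 1 ℕ.≤ n × p0 ≢ 0ℚ × Injective _≡_ _≡_ p
     × (∀ x → ft x ≡ p0 * prod s (λ i → x - p i))
     × (∀ y → gt y ≡ p0 * prod s (λ i → eval G0 y - p i))
     × PTE n s (λ i → subConst G0 (p i))
     × (∀ (X : ℤ) → ft (eval G0 (X ℚ./ 1)) ≡ gt (X ℚ./ 1)))

Case2 : ℕ → ℕ → (ℚ → ℚ) → (ℚ → ℚ) → Set
Case2 degf degg ft gt =
  degf ∣ (2 ℕ.* degg) ×
  (Σ Poly λ G0 → Σ ℕ λ n → Σ ℚ λ q0 → Σ ℕ λ s → Σ (Fin s → ℚ) λ q →
     ¬ IsZeroPoly G0 × deg G0 ≡ n × 1 ℕ.≤ n × q0 ≢ 0ℚ × Injective _≡_ _≡_ q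
     × (∀ i → 0ℚ < q i)
     × (∀ x → ft x ≡ q0 * prod s (λ i → (x - q i) * (x + q i)))
     × (∀ y → gt y ≡ q0 * prod s (λ i → eval G0 y - q i ^ 2))
     × AtMostTwoOddRoots G0
     × PTE n s (λ i → subConst G0 (q i ^ 2))
     × InfManyBoundedDenom (λ x y → x ^ 2 ≡ eval G0 y × ft x ≡ gt y))

{-# OPTIONS --safe #-}
module Submission where

-- After undoing the linear maps, f and g become φ ∘ F and φ ∘ G, and f has
-- deg φ · deg F distinct rational roots. If F = x^q with q ≥ 3 this is impossible:
-- x ↦ x^q is injective on the positive and on the non-positive rationals, so φ(x^q)
-- has at most 2 deg φ rational zeros (likewise for G). Using deg F ≤ deg G, the
-- remaining standard pairs have F linear or F = γx² + δ, G = γG₀ + δ. In the first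
-- case φ splits as p₀ ∏ (x - pᵢ), so φ ∘ G = p₀ ∏ (G - pᵢ); in the second the zeros of
-- φ(γx² + δ) are ±qᵢ, so φ(γt + δ) = q₀ ∏ (t - qᵢ²) and φ ∘ G = q₀ ∏ (G₀ - qᵢ²).
-- Each factor G₀ - c has at most deg G₀ roots while g has deg φ · deg G₀ of them, so by
-- counting every factor has exactly deg G₀ simple rational roots: a PTE set.

open import Defs
open import Level using (0ℓ)
open import Function using (_∘_)
open import Function.Definitions using (Injective)
open import Data.Empty using (⊥; ⊥-elim)
open import Data.Product using (Σ; ∃; _×_; _,_; proj₁; proj₂)
open import Data.Sum using (_⊎_; inj₁; inj₂)
open import Data.Maybe using (just; nothing)
open import Data.Nat as ℕ using (ℕ; zero; suc; z≤n; s≤s)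
import Data.Nat.Properties as ℕ
open import Data.Nat.Divisibility using (_∣_; m∣m*n)
open import Data.Fin as Fin using (Fin)
import Data.Fin.Properties as Fin
import Data.Integer as ℤ
import Data.Integer.Properties as ℤ
open import Data.Rational as ℚ
  using (ℚ; ↥_; 0ℚ; 1ℚ; _+_; _*_; _-_; -_; 1/_; _≤_; _<_; NonZero; ≢-nonZero; positive; nonNegative)
open import Data.Rational.Literals using (fromℤ)
open import Data.Rational.Properties
open import Data.List using (List; []; _∷_; length; filter; lookup; tabulate)
open import Data.List.Properties using (length-tabulate)
open import Data.List.Membership.Propositional.Properties using (∈-lookup)
open import Data.List.Relation.Unary.All as All using (All; []; _∷_)
import Data.List.Relation.Unary.All.Properties as All
open import Data.List.Relation.Unary.AllPairs using ([]; _∷_)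
open import Data.List.Relation.Unary.Unique.Propositional using (Unique)
import Data.List.Relation.Unary.Unique.Propositional.Properties as Unique
open import Relation.Nullary using (¬_; yes; no)
open import Relation.Nullary.Decidable using (dec⇒maybe; decidable-stable)
open import Relation.Unary using (Pred; Decidable; _∩_; ∁; _⊆_; ⋃)
open import Relation.Unary.Properties using (∁?)
open import Relation.Binary using (tri<; tri≈; tri>)
open import Relation.Binary.PropositionalEquality
open import Algebra.Apartness.Properties.HeytingCommutativeRing heytingCommutativeRing
  using () renaming (x#0y#0→xy#0 to *-≢0)
open import Algebra.Properties.Group +-0-group using (x∙y⁻¹≈ε⇒x≈y)
open import Tactic.RingSolver using (solve-∀)
open import Tactic.RingSolver.Core.AlmostCommutativeRing using (AlmostCommutativeRing; fromCommutativeRing)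
open import Data.Nat.Tactic.RingSolver using () renaming (solve-∀ to ℕ-solve-∀)

private
  variable
    x y : ℚ

ℚ-ring : AlmostCommutativeRing 0ℓ 0ℓ
ℚ-ring = fromCommutativeRing +-*-commutativeRing (λ x → dec⇒maybe (0ℚ ≟ x))

x*y≡0⇒y≡0 : x ≢ 0ℚ → x * y ≡ 0ℚ → y ≡ 0ℚ
x*y≡0⇒y≡0 {y = y} x≢0 xy≡0 = decidable-stable (y ≟ 0ℚ) (λ y≢0 → *-≢0 x≢0 y≢0 xy≡0)

x*y≡0⇒x≡0⊎y≡0 : x * y ≡ 0ℚ → x ≡ 0ℚ ⊎ y ≡ 0ℚ
x*y≡0⇒x≡0⊎y≡0 {x} xy≡0 with x ≟ 0ℚ
... | yes x≡0 = inj₁ x≡0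
... | no  x≢0 = inj₂ (x*y≡0⇒y≡0 x≢0 xy≡0)

x≢y⇒x-y≢0 : x ≢ y → x - y ≢ 0ℚ
x≢y⇒x-y≢0 {x} {y} x≢y = x≢y ∘ x∙y⁻¹≈ε⇒x≈y x y

1/-≢0 : ∀ x .{{_ : NonZero x}} → 1/ x ≢ 0ℚ
1/-≢0 x 1/x≡0 = 1≢0 (begin
  1ℚ         ≡⟨ sym (*-inverseʳ x) ⟩
  x * 1/ x   ≡⟨ cong (x *_) 1/x≡0 ⟩
  x * 0ℚ     ≡⟨ *-zeroʳ x ⟩
  0ℚ         ∎)
  where open ≡-Reasoning

^-≢0 : ∀ n → x ≢ 0ℚ → x ^ n ≢ 0ℚ
^-≢0 zero    _   = 1≢0
^-≢0 (suc n) x≢0 = *-≢0 x≢0 (^-≢0 n x≢0)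

^-pos : ∀ n → 0ℚ < x → 0ℚ < x ^ n
^-pos zero    _   = positive⁻¹ 1ℚ
^-pos {x} (suc n) 0<x =
  subst (_< x * x ^ n) (*-zeroˡ (x ^ n)) (*-monoˡ-<-pos (x ^ n) {{positive (^-pos n 0<x)}} 0<x)

^-nonNeg : ∀ n → 0ℚ ≤ x → 0ℚ ≤ x ^ n
^-nonNeg zero    _   = nonNegative⁻¹ 1ℚ
^-nonNeg {x} (suc n) 0≤x =
  subst (_≤ x * x ^ n) (*-zeroˡ (x ^ n)) (*-monoʳ-≤-nonNeg (x ^ n) {{nonNegative (^-nonNeg n 0≤x)}} 0≤x)

^-mono-≤ : ∀ n → 0ℚ ≤ x → x ≤ y → x ^ n ≤ y ^ n
^-mono-≤ zero    _   _   = ≤-refl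
^-mono-≤ {x} {y} (suc n) 0≤x x≤y = ≤-trans
  (*-monoˡ-≤-nonNeg x {{nonNegative 0≤x}} (^-mono-≤ n 0≤x x≤y))
  (*-monoʳ-≤-nonNeg (y ^ n) {{nonNegative (^-nonNeg n (≤-trans 0≤x x≤y))}} x≤y)

^-mono-< : ∀ n → 0ℚ ≤ x → x < y → x ^ suc n < y ^ suc n
^-mono-< {x} {y} n 0≤x x<y = ≤-<-trans
  (*-monoˡ-≤-nonNeg x {{nonNegative 0≤x}} (^-mono-≤ n 0≤x (<⇒≤ x<y)))
  (*-monoˡ-<-pos (y ^ n) {{positive (^-pos n (≤-<-trans 0≤x x<y))}} x<y)

^-injective-nonNeg : ∀ n → 0ℚ ≤ x → 0ℚ ≤ y → x ^ suc n ≡ y ^ suc n → x ≡ y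
^-injective-nonNeg {x} {y} n 0≤x 0≤y xⁿ≡yⁿ with <-cmp x y
... | tri< x<y _ _ = ⊥-elim (<-irrefl xⁿ≡yⁿ (^-mono-< n 0≤x x<y))
... | tri≈ _ x≡y _ = x≡y
... | tri> _ _ y<x = ⊥-elim (<-irrefl (sym xⁿ≡yⁿ) (^-mono-< n 0≤y y<x))

neg-^ : ∀ n x → (- x) ^ n ≡ (- 1ℚ) ^ n * x ^ n
neg-^ zero    x = sym (*-identityˡ 1ℚ)
neg-^ (suc n) x = trans (cong (- x *_) (neg-^ n x)) (lemma x ((- 1ℚ) ^ n) (x ^ n))
  where
  lemma : ∀ x a b → - x * (a * b) ≡ (- 1ℚ * a) * (x * b)
  lemma = solve-∀ ℚ-ring

^-injective-nonPos : ∀ n → x ≤ 0ℚ → y ≤ 0ℚ → x ^ suc n ≡ y ^ suc n → x ≡ y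
^-injective-nonPos {x} {y} n x≤0 y≤0 xⁿ≡yⁿ = neg-injective
  (^-injective-nonNeg n (neg-antimono-≤ x≤0) (neg-antimono-≤ y≤0) (begin
    (- x) ^ suc n                 ≡⟨ neg-^ (suc n) x ⟩
    (- 1ℚ) ^ suc n * x ^ suc n    ≡⟨ cong ((- 1ℚ) ^ suc n *_) xⁿ≡yⁿ ⟩
    (- 1ℚ) ^ suc n * y ^ suc n    ≡⟨ neg-^ (suc n) y ⟨
    (- y) ^ suc n                 ∎))
  where open ≡-Reasoning

m+n≡o+p⇒m≡o×n≡p : ∀ {p q a b} → p ℕ.≤ a → q ℕ.≤ b → p ℕ.+ q ≡ a ℕ.+ b → p ≡ a × q ≡ b
m+n≡o+p⇒m≡o×n≡p {p} {q} {a} {b} p≤a q≤b p+q≡a+b =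
    ℕ.≤-antisym p≤a (ℕ.+-cancelʳ-≤ b a p (subst (ℕ._≤ p ℕ.+ b) p+q≡a+b (ℕ.+-monoʳ-≤ p q≤b)))
  , ℕ.≤-antisym q≤b (ℕ.+-cancelˡ-≤ a b q (subst (ℕ._≤ a ℕ.+ q) p+q≡a+b (ℕ.+-monoˡ-≤ q p≤a)))

-- Counting distinct elements

lookup-injective : ∀ {A : Set} {xs : List A} → Unique xs → Injective _≡_ _≡_ (lookup xs)
lookup-injective {xs = _ ∷ _} (_    ∷ _)   {Fin.zero}  {Fin.zero}  _ = refl
lookup-injective {xs = _ ∷ _} (x∉xs ∷ _)   {Fin.zero}  {Fin.suc j} e = ⊥-elim (All.lookup x∉xs (∈-lookup j) e)
lookup-injective {xs = _ ∷ _} (x∉xs ∷ _)   {Fin.suc i} {Fin.zero}  e = ⊥-elim (All.lookup x∉xs (∈-lookup i) (sym e))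
lookup-injective {xs = _ ∷ _} (_    ∷ xs!) {Fin.suc i} {Fin.suc j} e = cong Fin.suc (lookup-injective xs! e)

module _ {A : Set} where

  record Witnesses (P : Pred A 0ℓ) (n : ℕ) : Set where
    constructor witnesses
    field
      point           : Fin n → A
      point-injective : Injective _≡_ _≡_ point
      satisfies       : ∀ i → P (point i)

  AtMost : Pred A 0ℓ → ℕ → Set
  AtMost P n = ∀ {k} → Witnesses P k → k ℕ.≤ n

  Witnesses-mono : ∀ {P Q n} → P ⊆ Q → Witnesses P n → Witnesses Q n
  Witnesses-mono P⊆Q (witnesses r r-inj Pr) = witnesses r r-inj (P⊆Q ∘ Pr)

  AtMost-anti : ∀ {P Q n} → P ⊆ Q → AtMost Q n → AtMost P n
  AtMost-anti P⊆Q Q≤n = Q≤n ∘ Witnesses-mono P⊆Q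

  length-filter-∁ : ∀ {C : Pred A 0ℓ} (C? : Decidable C) xs →
    length (filter C? xs) ℕ.+ length (filter (∁? C?) xs) ≡ length xs
  length-filter-∁ C? []       = refl
  length-filter-∁ C? (x ∷ xs) with C? x
  ... | yes _ = cong suc (length-filter-∁ C? xs)
  ... | no  _ = trans (ℕ.+-suc _ _) (cong suc (length-filter-∁ C? xs))

  private
    filter-Witnesses : ∀ {D R : Pred A 0ℓ} (D? : Decidable D) {xs} → Unique xs → All R xs →
      Witnesses (D ∩ R) (length (filter D? xs))
    filter-Witnesses D? {xs} xs! Rxs =
      witnesses (lookup (filter D? xs)) (lookup-injective (Unique.filter⁺ D? xs!)) λ i → All.lookup (All.zip (All.all-filter D? xs , All.filter⁺ D? Rxs)) (∈-lookup i)

  Witnesses-partition : ∀ {C R : Pred A 0ℓ} → Decidable C → ∀ {k} → Witnesses R k →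
    Σ ℕ λ a → Σ ℕ λ b → Witnesses (C ∩ R) a × Witnesses (∁ C ∩ R) b × a ℕ.+ b ≡ k
  Witnesses-partition C? (witnesses r r-inj Rr) =
      _ , _ , filter-Witnesses C? r! (All.tabulate⁺ Rr) , filter-Witnesses (∁? C?) r! (All.tabulate⁺ Rr)
    , trans (length-filter-∁ C? (tabulate r)) (length-tabulate r)
    where r! = Unique.tabulate⁺ r-inj

  module _ {C R : Pred A 0ℓ} (C? : Decidable C) {a b} (Ca : AtMost (C ∩ R) a) (∁Cb : AtMost (∁ C ∩ R) b) where

    AtMost-split : AtMost R (a ℕ.+ b)
    AtMost-split W with _ , _ , W₁ , W₂ , a′+b′≡k ← Witnesses-partition C? W =
      subst (ℕ._≤ a ℕ.+ b) a′+b′≡k (ℕ.+-mono-≤ (Ca W₁) (∁Cb W₂))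

    Witnesses-split : Witnesses R (a ℕ.+ b) → Witnesses (C ∩ R) a × Witnesses (∁ C ∩ R) b
    Witnesses-split W with _ , _ , W₁ , W₂ , a′+b′≡a+b ← Witnesses-partition C? W
      with refl , refl ← m+n≡o+p⇒m≡o×n≡p (Ca W₁) (∁Cb W₂) a′+b′≡a+b = W₁ , W₂

  ∁-head∩⋃⊆⋃-tail : ∀ {s} {P : Fin (suc s) → Pred A 0ℓ} →
    ∁ (P Fin.zero) ∩ ⋃ (Fin (suc s)) P ⊆ ⋃ (Fin s) (P ∘ Fin.suc)
  ∁-head∩⋃⊆⋃-tail (¬P₀x , Fin.zero  , P₀x) = ⊥-elim (¬P₀x P₀x)
  ∁-head∩⋃⊆⋃-tail (_    , Fin.suc i , Pᵢx) = i , Pᵢx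

  module _ {n : ℕ} where

    AtMost-⋃ : ∀ {s} {P : Fin s → Pred A 0ℓ} → (∀ i → Decidable (P i)) → (∀ i → AtMost (P i) n) →
      AtMost (⋃ (Fin s) P) (s ℕ.* n)
    AtMost-⋃ {zero}  _ _ {zero}  _            = z≤n
    AtMost-⋃ {zero}  _ _ {suc _} (witnesses _ _ Pr) with () ← proj₁ (Pr Fin.zero)
    AtMost-⋃ {suc s} {P} P? Pn =
      AtMost-split (P? Fin.zero) (AtMost-anti proj₁ (Pn Fin.zero))
        (AtMost-anti (∁-head∩⋃⊆⋃-tail {P = P}) (AtMost-⋃ (P? ∘ Fin.suc) (Pn ∘ Fin.suc)))

    private
      split-head : ∀ {s} {P : Fin (suc s) → Pred A 0ℓ} → (∀ i → Decidable (P i)) → (∀ i → AtMost (P i) n) →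
        Witnesses (⋃ (Fin (suc s)) P) (suc s ℕ.* n) →
        Witnesses (P Fin.zero) n × Witnesses (⋃ (Fin s) (P ∘ Fin.suc)) (s ℕ.* n)
      split-head {P = P} P? Pn W =
        let W₀ , W₊ = Witnesses-split (P? Fin.zero) (AtMost-anti proj₁ (Pn Fin.zero))
                        (AtMost-anti (∁-head∩⋃⊆⋃-tail {P = P}) (AtMost-⋃ (P? ∘ Fin.suc) (Pn ∘ Fin.suc))) W
        in Witnesses-mono proj₁ W₀ , Witnesses-mono (∁-head∩⋃⊆⋃-tail {P = P}) W₊

    Witnesses-⋃ : ∀ {s} {P : Fin s → Pred A 0ℓ} → (∀ i → Decidable (P i)) → (∀ i → AtMost (P i) n) →
      Witnesses (⋃ (Fin s) P) (s ℕ.* n) → ∀ i → Witnesses (P i) n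
    Witnesses-⋃ P? Pn W Fin.zero    = proj₁ (split-head P? Pn W)
    Witnesses-⋃ P? Pn W (Fin.suc i) = Witnesses-⋃ (P? ∘ Fin.suc) (Pn ∘ Fin.suc) (proj₂ (split-head P? Pn W)) i

module _ {A B : Set} {P : Pred A 0ℓ} {Q : Pred B 0ℓ} (f : A → B)
         (f-injective-on-P : ∀ {x y} → P x → P y → f x ≡ f y → x ≡ y) (P⇒Q∘f : ∀ {x} → P x → Q (f x)) where

  Witnesses-image : ∀ {n} → Witnesses P n → Witnesses Q n
  Witnesses-image (witnesses r r-inj Pr) =
    witnesses (f ∘ r) (λ e → r-inj (f-injective-on-P (Pr _) (Pr _) e)) (P⇒Q∘f ∘ Pr)

  AtMost-preimage : ∀ {n} → AtMost Q n → AtMost P n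
  AtMost-preimage Qn = Qn ∘ Witnesses-image

-- Polynomials

coeff : Poly → ℕ → ℚ
coeff []       k       = 0ℚ
coeff (a ∷ as) zero    = a
coeff (a ∷ as) (suc k) = coeff as k

AllCoeffsZero : Poly → Set
AllCoeffsZero P = ∀ k → coeff P k ≡ 0ℚ

record DegreeAtMost (P : Poly) (d : ℕ) : Set where
  constructor degreeAtMost
  field vanish : ∀ k → d ℕ.< k → coeff P k ≡ 0ℚ
open DegreeAtMost public

record HasDegree (P : Poly) (d : ℕ) : Set where
  constructor hasDegree
  field
    leading≢0 : coeff P d ≢ 0ℚ
    atMost    : DegreeAtMost P d
open HasDegree public

private
  variable
    a c : ℚ
    P Q : Poly
    d e k : ℕ

DegreeAtMost-[] : DegreeAtMost [] d
DegreeAtMost-[] = degreeAtMost λ _ _ → refl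

DegreeAtMost-tail : DegreeAtMost (a ∷ P) (suc d) → DegreeAtMost P d
DegreeAtMost-tail P≤ = degreeAtMost λ k d<k → vanish P≤ (suc k) (s≤s d<k)

DegreeAtMost0-tail : DegreeAtMost (a ∷ P) 0 → AllCoeffsZero P
DegreeAtMost0-tail P≤ k = vanish P≤ (suc k) (s≤s z≤n)

DegreeAtMost-∷ : DegreeAtMost P d → DegreeAtMost (a ∷ P) (suc d)
DegreeAtMost-∷ P≤ = degreeAtMost λ { (suc k) (s≤s d<k) → vanish P≤ k d<k }

DegreeAtMost0-∷ : AllCoeffsZero P → DegreeAtMost (a ∷ P) 0
DegreeAtMost0-∷ P≡0 = degreeAtMost λ { (suc k) _ → P≡0 k }

HasDegree-∷ : HasDegree P d → HasDegree (a ∷ P) (suc d)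
HasDegree-∷ P° = hasDegree (leading≢0 P°) (DegreeAtMost-∷ (atMost P°))

HasDegree-const : c ≢ 0ℚ → HasDegree (c ∷ []) 0
HasDegree-const c≢0 = hasDegree c≢0 (DegreeAtMost0-∷ λ _ → refl)

HasDegree-unique : HasDegree P d → HasDegree P e → d ≡ e
HasDegree-unique {d = d} {e} P°d P°e with ℕ.<-cmp d e
... | tri< d<e _ _ = ⊥-elim (leading≢0 P°e (vanish (atMost P°d) e d<e))
... | tri≈ _ d≡e _ = d≡e
... | tri> _ _ e<d = ⊥-elim (leading≢0 P°d (vanish (atMost P°e) d e<d))

degM≡nothing⇒AllCoeffsZero : ∀ P → degM P ≡ nothing → AllCoeffsZero P
degM≡nothing⇒AllCoeffsZero []       _ _ = refl
degM≡nothing⇒AllCoeffsZero (a ∷ as) h k with degM as in eq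
... | just _  with () ← h
... | nothing with a ≟ 0ℚ
...   | no _ with () ← h
degM≡nothing⇒AllCoeffsZero (a ∷ as) h zero    | nothing | yes a≡0 = a≡0
degM≡nothing⇒AllCoeffsZero (a ∷ as) h (suc k) | nothing | yes _   = degM≡nothing⇒AllCoeffsZero as eq k

degM≡just⇒HasDegree : ∀ P → degM P ≡ just d → HasDegree P d
degM≡just⇒HasDegree (a ∷ as) h with degM as in eq
degM≡just⇒HasDegree (a ∷ as) refl | just _ = HasDegree-∷ (degM≡just⇒HasDegree as eq)
... | nothing with a ≟ 0ℚ
...   | yes _ with () ← h
degM≡just⇒HasDegree (a ∷ as) refl | nothing | no a≢0 =
  hasDegree a≢0 (DegreeAtMost0-∷ (degM≡nothing⇒AllCoeffsZero as eq))

HasDegree⇒degM≡just : HasDegree P d → degM P ≡ just d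
HasDegree⇒degM≡just {P} {d} P° with degM P in eq
... | just e  = cong just (HasDegree-unique (degM≡just⇒HasDegree P eq) P°)
... | nothing = ⊥-elim (leading≢0 P° (degM≡nothing⇒AllCoeffsZero P eq d))

HasDegree⇒deg≡ : HasDegree P d → deg P ≡ d
HasDegree⇒deg≡ {P} P° with degM P | HasDegree⇒degM≡just P°
... | just _ | refl = refl

HasDegree⇒nonZero : HasDegree P d → ¬ IsZeroPoly P
HasDegree⇒nonZero {P} P° P≡0 with () ← trans (sym (HasDegree⇒degM≡just P°)) P≡0

zero-or-HasDegree : ∀ P → AllCoeffsZero P ⊎ HasDegree P (deg P)
zero-or-HasDegree P with degM P in eq
... | nothing = inj₁ (degM≡nothing⇒AllCoeffsZero P eq)
... | just d  = inj₂ (degM≡just⇒HasDegree P eq)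

nonZero⇒HasDegree : ∀ P → ¬ IsZeroPoly P → HasDegree P (deg P)
nonZero⇒HasDegree P P≢0 with degM P in eq
... | nothing = ⊥-elim (P≢0 refl)
... | just d  = degM≡just⇒HasDegree P eq

eval-AllCoeffsZero : ∀ P → AllCoeffsZero P → ∀ x → eval P x ≡ 0ℚ
eval-AllCoeffsZero []      _   x = refl
eval-AllCoeffsZero (a ∷ P) P≡0 x = begin
  a + x * eval P x  ≡⟨ cong₂ (λ a v → a + x * v) (P≡0 0) (eval-AllCoeffsZero P (P≡0 ∘ suc) x) ⟩
  0ℚ + x * 0ℚ       ≡⟨ cong (0ℚ +_) (*-zeroʳ x) ⟩
  0ℚ                ∎
  where open ≡-Reasoning

eval-const : DegreeAtMost P 0 → ∀ x → eval P x ≡ coeff P 0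
eval-const {[]}    _  x = refl
eval-const {a ∷ P} P≤ x = begin
  a + x * eval P x  ≡⟨ cong (λ v → a + x * v) (eval-AllCoeffsZero P (DegreeAtMost0-tail P≤) x) ⟩
  a + x * 0ℚ        ≡⟨ cong (a +_) (*-zeroʳ x) ⟩
  a + 0ℚ            ≡⟨ +-identityʳ a ⟩
  a                 ∎
  where open ≡-Reasoning

eval-linear : DegreeAtMost P 1 → ∀ x → eval P x ≡ coeff P 1 * x + coeff P 0
eval-linear {[]}    _  x = sym (trans (+-identityʳ (0ℚ * x)) (*-zeroˡ x))
eval-linear {a ∷ P} P≤ x = begin
  a + x * eval P x             ≡⟨ cong (λ v → a + x * v) (eval-const (DegreeAtMost-tail P≤) x) ⟩
  a + x * coeff P 0            ≡⟨ +-comm a _ ⟩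
  x * coeff P 0 + a            ≡⟨ cong (_+ a) (*-comm x _) ⟩
  coeff P 0 * x + a            ∎
  where open ≡-Reasoning

add : Poly → Poly → Poly
add []      Q       = Q
add (a ∷ P) []      = a ∷ P
add (a ∷ P) (b ∷ Q) = (a + b) ∷ add P Q

coeff-add : ∀ P Q k → coeff (add P Q) k ≡ coeff P k + coeff Q k
coeff-add []      Q       k       = sym (+-identityˡ _)
coeff-add (a ∷ P) []      zero    = sym (+-identityʳ _)
coeff-add (a ∷ P) []      (suc k) = sym (+-identityʳ _)
coeff-add (a ∷ P) (b ∷ Q) zero    = refl
coeff-add (a ∷ P) (b ∷ Q) (suc k) = coeff-add P Q k

eval-add : ∀ P Q x → eval (add P Q) x ≡ eval P x + eval Q x
eval-add []      Q       x = sym (+-identityˡ _)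
eval-add (a ∷ P) []      x = sym (+-identityʳ _)
eval-add (a ∷ P) (b ∷ Q) x = trans (cong (λ v → (a + b) + x * v) (eval-add P Q x)) (lemma a b x (eval P x) (eval Q x))
  where
  lemma : ∀ a b x u v → (a + b) + x * (u + v) ≡ (a + x * u) + (b + x * v)
  lemma = solve-∀ ℚ-ring

scale : ℚ → Poly → Poly
scale c []      = []
scale c (a ∷ P) = c * a ∷ scale c P

coeff-scale : ∀ c P k → coeff (scale c P) k ≡ c * coeff P k
coeff-scale c []      k       = sym (*-zeroʳ c)
coeff-scale c (a ∷ P) zero    = refl
coeff-scale c (a ∷ P) (suc k) = coeff-scale c P k

eval-scale : ∀ c P x → eval (scale c P) x ≡ c * eval P x
eval-scale c []      x = sym (*-zeroʳ c)
eval-scale c (a ∷ P) x = trans (cong (λ v → c * a + x * v) (eval-scale c P x)) (lemma c a x (eval P x))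
  where
  lemma : ∀ c a x v → c * a + x * (c * v) ≡ c * (a + x * v)
  lemma = solve-∀ ℚ-ring

HasDegree-scale : c ≢ 0ℚ → HasDegree P d → HasDegree (scale c P) d
HasDegree-scale {c} {P} {d} c≢0 P° = hasDegree
  (λ lc≡0 → *-≢0 c≢0 (leading≢0 P°) (trans (sym (coeff-scale c P d)) lc≡0))
  (degreeAtMost λ k d<k → trans (coeff-scale c P k) (trans (cong (c *_) (vanish (atMost P°) k d<k)) (*-zeroʳ c)))

mul : Poly → Poly → Poly
mul []      Q = []
mul (a ∷ P) Q = add (scale a Q) (0ℚ ∷ mul P Q)

eval-mul : ∀ P Q x → eval (mul P Q) x ≡ eval P x * eval Q x
eval-mul []      Q x = sym (*-zeroˡ (eval Q x))
eval-mul (a ∷ P) Q x = begin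
  eval (add (scale a Q) (0ℚ ∷ mul P Q)) x        ≡⟨ eval-add (scale a Q) (0ℚ ∷ mul P Q) x ⟩
  eval (scale a Q) x + (0ℚ + x * eval (mul P Q) x) ≡⟨ cong₂ (λ u v → u + (0ℚ + x * v)) (eval-scale a Q x) (eval-mul P Q x) ⟩
  a * eval Q x + (0ℚ + x * (eval P x * eval Q x))  ≡⟨ lemma a x (eval P x) (eval Q x) ⟩
  (a + x * eval P x) * eval Q x                    ∎
  where
  open ≡-Reasoning
  lemma : ∀ a x p q → a * q + (0ℚ + x * (p * q)) ≡ (a + x * p) * q
  lemma = solve-∀ ℚ-ring

coeff-mul-∷ : ∀ a P Q k → coeff (mul (a ∷ P) Q) k ≡ a * coeff Q k + coeff (0ℚ ∷ mul P Q) k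
coeff-mul-∷ a P Q k = trans (coeff-add (scale a Q) (0ℚ ∷ mul P Q) k) (cong (_+ _) (coeff-scale a Q k))

AllCoeffsZero-mulˡ : ∀ P Q → AllCoeffsZero P → AllCoeffsZero (mul P Q)
AllCoeffsZero-mulˡ []      Q _   k = refl
AllCoeffsZero-mulˡ (a ∷ P) Q P≡0 k = begin
  coeff (mul (a ∷ P) Q) k                     ≡⟨ coeff-mul-∷ a P Q k ⟩
  a * coeff Q k + coeff (0ℚ ∷ mul P Q) k      ≡⟨ cong₂ _+_ (trans (cong (_* coeff Q k) (P≡0 0)) (*-zeroˡ (coeff Q k))) (tail k) ⟩
  0ℚ + 0ℚ                                     ≡⟨ +-identityʳ 0ℚ ⟩
  0ℚ                                          ∎
  where
  open ≡-Reasoning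
  tail : ∀ k → coeff (0ℚ ∷ mul P Q) k ≡ 0ℚ
  tail zero    = refl
  tail (suc k) = AllCoeffsZero-mulˡ P Q (P≡0 ∘ suc) k

AllCoeffsZero-mulʳ : ∀ P Q → AllCoeffsZero Q → AllCoeffsZero (mul P Q)
AllCoeffsZero-mulʳ []      Q _   k = refl
AllCoeffsZero-mulʳ (a ∷ P) Q Q≡0 k = begin
  coeff (mul (a ∷ P) Q) k                     ≡⟨ coeff-mul-∷ a P Q k ⟩
  a * coeff Q k + coeff (0ℚ ∷ mul P Q) k      ≡⟨ cong₂ _+_ (trans (cong (a *_) (Q≡0 k)) (*-zeroʳ a)) (tail k) ⟩
  0ℚ + 0ℚ                                     ≡⟨ +-identityʳ 0ℚ ⟩
  0ℚ                                          ∎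
  where
  open ≡-Reasoning
  tail : ∀ k → coeff (0ℚ ∷ mul P Q) k ≡ 0ℚ
  tail zero    = refl
  tail (suc k) = AllCoeffsZero-mulʳ P Q Q≡0 k

mul-top : ∀ P Q d e → DegreeAtMost P d → DegreeAtMost Q e →
  DegreeAtMost (mul P Q) (d ℕ.+ e) × coeff (mul P Q) (d ℕ.+ e) ≡ coeff P d * coeff Q e
mul-top []      Q d       e _  _  = DegreeAtMost-[] , sym (*-zeroˡ (coeff Q e))
mul-top (a ∷ P) Q zero    e P≤ Q≤ = degreeAtMost above , top
  where
  tail≡0 : AllCoeffsZero (0ℚ ∷ mul P Q)
  tail≡0 zero    = refl
  tail≡0 (suc k) = AllCoeffsZero-mulˡ P Q (DegreeAtMost0-tail P≤) k
  above : ∀ k → e ℕ.< k → coeff (mul (a ∷ P) Q) k ≡ 0ℚ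
  above k e<k rewrite coeff-mul-∷ a P Q k | tail≡0 k | vanish Q≤ k e<k = trans (+-identityʳ _) (*-zeroʳ a)
  top : coeff (mul (a ∷ P) Q) e ≡ a * coeff Q e
  top rewrite coeff-mul-∷ a P Q e | tail≡0 e = +-identityʳ _
mul-top (a ∷ P) Q (suc d) e P≤ Q≤ = degreeAtMost above , top
  where
  IH = mul-top P Q d e (DegreeAtMost-tail P≤) Q≤
  above : ∀ k → suc (d ℕ.+ e) ℕ.< k → coeff (mul (a ∷ P) Q) k ≡ 0ℚ
  above (suc k) (s≤s d+e<k) rewrite coeff-mul-∷ a P Q (suc k)
    | vanish Q≤ (suc k) (s≤s (ℕ.≤-trans (ℕ.m≤n+m e d) (ℕ.<⇒≤ d+e<k)))
    | vanish (proj₁ IH) k d+e<k = trans (+-identityʳ _) (*-zeroʳ a)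
  top : coeff (mul (a ∷ P) Q) (suc (d ℕ.+ e)) ≡ coeff P d * coeff Q e
  top rewrite coeff-mul-∷ a P Q (suc (d ℕ.+ e)) | vanish Q≤ (suc (d ℕ.+ e)) (s≤s (ℕ.m≤n+m e d)) =
    trans (cong (_+ _) (*-zeroʳ a)) (trans (+-identityˡ _) (proj₂ IH))

HasDegree-mul : HasDegree P d → HasDegree Q e → HasDegree (mul P Q) (d ℕ.+ e)
HasDegree-mul {P} {d} {Q} {e} P° Q° =
  let P*Q≤ , top = mul-top P Q d e (atMost P°) (atMost Q°) in
  hasDegree (*-≢0 (leading≢0 P°) (leading≢0 Q°) ∘ trans (sym top)) P*Q≤

comp : Poly → Poly → Poly
comp []      Q = []
comp (a ∷ P) Q = add (a ∷ []) (mul Q (comp P Q))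

eval-comp : ∀ P Q x → eval (comp P Q) x ≡ eval P (eval Q x)
eval-comp []      Q x = refl
eval-comp (a ∷ P) Q x = begin
  eval (add (a ∷ []) (mul Q (comp P Q))) x          ≡⟨ eval-add (a ∷ []) (mul Q (comp P Q)) x ⟩
  (a + x * 0ℚ) + eval (mul Q (comp P Q)) x          ≡⟨ cong₂ _+_ (trans (cong (a +_) (*-zeroʳ x)) (+-identityʳ a))
                                                                 (eval-mul Q (comp P Q) x) ⟩
  a + eval Q x * eval (comp P Q) x                  ≡⟨ cong (λ v → a + eval Q x * v) (eval-comp P Q x) ⟩
  a + eval Q x * eval P (eval Q x)                  ∎
  where open ≡-Reasoning

coeff-comp-∷ : ∀ a P Q k → coeff (comp (a ∷ P) Q) (suc k) ≡ coeff (mul Q (comp P Q)) (suc k)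
coeff-comp-∷ a P Q k = trans (coeff-add (a ∷ []) (mul Q (comp P Q)) (suc k)) (+-identityˡ _)

AllCoeffsZero-comp : ∀ P Q → AllCoeffsZero P → AllCoeffsZero (comp P Q)
AllCoeffsZero-comp []      Q _   k = refl
AllCoeffsZero-comp (a ∷ P) Q P≡0 k
  rewrite coeff-add (a ∷ []) (mul Q (comp P Q)) k
        | AllCoeffsZero-mulʳ Q (comp P Q) (AllCoeffsZero-comp P Q (P≡0 ∘ suc)) k
  = trans (+-identityʳ _) (head k)
  where
  head : ∀ k → coeff (a ∷ []) k ≡ 0ℚ
  head zero    = P≡0 0
  head (suc k) = refl

comp-top : ∀ P Q d e → DegreeAtMost P d → DegreeAtMost Q (suc e) →
  DegreeAtMost (comp P Q) (d ℕ.* suc e) × coeff (comp P Q) (d ℕ.* suc e) ≡ coeff P d * coeff Q (suc e) ^ d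
comp-top []      Q d       e _  _  = DegreeAtMost-[] , sym (*-zeroˡ (coeff Q (suc e) ^ d))
comp-top (a ∷ P) Q zero    e P≤ Q≤ = degreeAtMost above , top
  where
  tail≡0 : AllCoeffsZero (mul Q (comp P Q))
  tail≡0 = AllCoeffsZero-mulʳ Q (comp P Q) (AllCoeffsZero-comp P Q (DegreeAtMost0-tail P≤))
  above : ∀ k → 0 ℕ.< k → coeff (comp (a ∷ P) Q) k ≡ 0ℚ
  above (suc k) _ = trans (coeff-comp-∷ a P Q k) (tail≡0 (suc k))
  top : coeff (comp (a ∷ P) Q) 0 ≡ a * 1ℚ
  top rewrite coeff-add (a ∷ []) (mul Q (comp P Q)) 0 | tail≡0 0 = trans (+-identityʳ a) (sym (*-identityʳ a))
comp-top (a ∷ P) Q (suc d) e P≤ Q≤ = degreeAtMost above , top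
  where
  IH = comp-top P Q d e (DegreeAtMost-tail P≤) Q≤
  Q*P∘Q = mul-top Q (comp P Q) (suc e) (d ℕ.* suc e) Q≤ (proj₁ IH)
  above : ∀ k → suc e ℕ.+ d ℕ.* suc e ℕ.< k → coeff (comp (a ∷ P) Q) k ≡ 0ℚ
  above (suc k) lt = trans (coeff-comp-∷ a P Q k) (vanish (proj₁ Q*P∘Q) (suc k) lt)
  top : coeff (comp (a ∷ P) Q) (suc e ℕ.+ d ℕ.* suc e) ≡ coeff P d * (coeff Q (suc e) * coeff Q (suc e) ^ d)
  top rewrite coeff-comp-∷ a P Q (e ℕ.+ d ℕ.* suc e) | proj₂ Q*P∘Q | proj₂ IH =
    lemma (coeff P d) (coeff Q (suc e)) (coeff Q (suc e) ^ d)
    where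
    lemma : ∀ p q r → q * (p * r) ≡ p * (q * r)
    lemma = solve-∀ ℚ-ring

HasDegree-comp : HasDegree P d → HasDegree Q (suc e) → HasDegree (comp P Q) (d ℕ.* suc e)
HasDegree-comp {P} {d} {Q} {e} P° Q° =
  let P∘Q≤ , top = comp-top P Q d e (atMost P°) (atMost Q°) in
  hasDegree (*-≢0 (leading≢0 P°) (^-≢0 d (leading≢0 Q°)) ∘ trans (sym top)) P∘Q≤

-- Roots and factorisation

Zero : (ℚ → ℚ) → Pred ℚ 0ℓ
Zero h x = h x ≡ 0ℚ

Root : Poly → Pred ℚ 0ℓ
Root P = Zero (eval P)

quot : Poly → ℚ → Poly
quot []       r = []
quot (a ∷ as) r = eval as r ∷ quot as r

eval-quot : ∀ P r x → eval P x ≡ (x - r) * eval (quot P r) x + eval P r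
eval-quot []       r x = sym (trans (+-identityʳ _) (*-zeroʳ (x - r)))
eval-quot (a ∷ as) r x = begin
  a + x * eval as x                                     ≡⟨ cong (λ v → a + x * v) (eval-quot as r x) ⟩
  a + x * ((x - r) * eval (quot as r) x + eval as r)    ≡⟨ lemma a x r (eval (quot as r) x) (eval as r) ⟩
  (x - r) * (eval as r + x * eval (quot as r) x) + (a + r * eval as r) ∎
  where
  open ≡-Reasoning
  lemma : ∀ a x r q v → a + x * ((x - r) * q + v) ≡ (x - r) * (v + x * q) + (a + r * v)
  lemma = solve-∀ ℚ-ring

quot-const : ∀ P r → DegreeAtMost P 0 → AllCoeffsZero (quot P r)
quot-const []       r _  k       = refl
quot-const (b ∷ bs) r P≤ zero    = eval-AllCoeffsZero bs (DegreeAtMost0-tail P≤) r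
quot-const (b ∷ bs) r P≤ (suc k) = quot-const bs r (degreeAtMost λ j _ → DegreeAtMost0-tail P≤ j) k

quot-top : ∀ P r d → DegreeAtMost P (suc d) → DegreeAtMost (quot P r) d × coeff (quot P r) d ≡ coeff P (suc d)
quot-top []       r d       _  = DegreeAtMost-[] , refl
quot-top (a ∷ as) r zero    P≤ =
  DegreeAtMost0-∷ (quot-const as r (DegreeAtMost-tail P≤)) ,
  eval-const (DegreeAtMost-tail P≤) r
quot-top (a ∷ as) r (suc d) P≤ =
  let Q≤ , top = quot-top as r d (DegreeAtMost-tail P≤) in DegreeAtMost-∷ Q≤ , top

HasDegree-quot : ∀ r → HasDegree P (suc d) → HasDegree (quot P r) d
HasDegree-quot {P} {d} r P° =
  let Q≤ , top = quot-top P r d (atMost P°) in hasDegree (leading≢0 P° ∘ trans (sym top)) Q≤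

Root-quot : ∀ P {x r} → Root P r → Root P x → x ≢ r → Root (quot P r) x
Root-quot P {x} {r} Pr≡0 Px≡0 x≢r = x*y≡0⇒y≡0 (x≢y⇒x-y≢0 x≢r) (begin
  (x - r) * eval (quot P r) x              ≡⟨ sym (+-identityʳ _) ⟩
  (x - r) * eval (quot P r) x + 0ℚ         ≡⟨ cong ((x - r) * eval (quot P r) x +_) (sym Pr≡0) ⟩
  (x - r) * eval (quot P r) x + eval P r   ≡⟨ sym (eval-quot P r x) ⟩
  eval P x                                 ≡⟨ Px≡0 ⟩
  0ℚ                                       ∎)
  where open ≡-Reasoning

quot-Witnesses : ∀ P {k} (W : Witnesses (Root P) (suc k)) →
  Witnesses (Root (quot P (Witnesses.point W Fin.zero))) k
quot-Witnesses P (witnesses r r-inj Pr) =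
  witnesses (r ∘ Fin.suc) (Fin.suc-injective ∘ r-inj)
    (λ i → Root-quot P (Pr Fin.zero) (Pr (Fin.suc i)) (λ e → Fin.0≢1+n (sym (r-inj e))))

roots-AtMost : HasDegree P d → AtMost (Root P) d
roots-AtMost _ {zero} _ = z≤n
roots-AtMost {P} {zero}  P° {suc k} (witnesses r _ Pr) =
  ⊥-elim (leading≢0 P° (trans (sym (eval-const (atMost P°) (r Fin.zero))) (Pr Fin.zero)))
roots-AtMost {P} {suc d} P° {suc k} W =
  s≤s (roots-AtMost (HasDegree-quot (Witnesses.point W Fin.zero) P°) (quot-Witnesses P W))

HasDegree-splits : HasDegree P d → (W : Witnesses (Root P) d) →
  ∀ x → eval P x ≡ coeff P d * prod d (λ i → x - Witnesses.point W i)
HasDegree-splits {P} {zero}  P° _ x = trans (eval-const (atMost P°) x) (sym (*-identityʳ _))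
HasDegree-splits {P} {suc d} P° W@(witnesses r _ Pr) x = begin
  eval P x                             ≡⟨ eval-quot P r₀ x ⟩
  (x - r₀) * eval P′ x + eval P r₀     ≡⟨ cong₂ (λ u v → (x - r₀) * u + v)
                                           (HasDegree-splits P′° (quot-Witnesses P W) x) (Pr Fin.zero) ⟩
  (x - r₀) * (coeff P′ d * Π) + 0ℚ     ≡⟨ lemma (x - r₀) (coeff P′ d) Π ⟩
  coeff P′ d * ((x - r₀) * Π)          ≡⟨ cong (_* ((x - r₀) * Π)) (proj₂ (quot-top P r₀ d (atMost P°))) ⟩
  coeff P (suc d) * ((x - r₀) * Π)     ∎
  where
  open ≡-Reasoning
  r₀  = r Fin.zero
  P′  = quot P r₀
  P′° = HasDegree-quot r₀ P°
  Π   = prod d (λ i → x - r (Fin.suc i))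
  lemma : ∀ u c p → u * (c * p) + 0ℚ ≡ c * (u * p)
  lemma = solve-∀ ℚ-ring

eval≗0⇒AllCoeffsZero : ∀ P → (∀ x → eval P x ≡ 0ℚ) → AllCoeffsZero P
eval≗0⇒AllCoeffsZero P P≗0 with zero-or-HasDegree P
... | inj₁ P≡0 = P≡0
... | inj₂ P°  = ⊥-elim (ℕ.<-irrefl refl (roots-AtMost P° (witnesses naturals naturals-injective (P≗0 ∘ naturals))))
  where
  naturals : Fin (suc (deg P)) → ℚ
  naturals i = fromℤ (ℤ.+ Fin.toℕ i)
  naturals-injective : Injective _≡_ _≡_ naturals
  naturals-injective = Fin.toℕ-injective ∘ ℤ.+-injective ∘ cong ↥_

eval≗⇒coeff≡ : ∀ P Q → eval P ≗ eval Q → ∀ k → coeff P k ≡ coeff Q k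
eval≗⇒coeff≡ P Q P≗Q k = begin
  coeff P k                                ≡⟨ lemma (coeff P k) (coeff Q k) ⟩
  (coeff P k + - 1ℚ * coeff Q k) + coeff Q k ≡⟨ cong (_+ coeff Q k) coeff-P-Q≡0 ⟩
  0ℚ + coeff Q k                           ≡⟨ +-identityˡ (coeff Q k) ⟩
  coeff Q k                                ∎
  where
  open ≡-Reasoning
  P-Q = add P (scale (- 1ℚ) Q)
  lemma : ∀ p q → p ≡ (p + - 1ℚ * q) + q
  lemma = solve-∀ ℚ-ring
  cancel : ∀ q → q + - 1ℚ * q ≡ 0ℚ
  cancel = solve-∀ ℚ-ring
  P-Q≗0 : ∀ x → eval P-Q x ≡ 0ℚ
  P-Q≗0 x = trans (eval-add P (scale (- 1ℚ) Q) x)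
                  (trans (cong₂ _+_ (P≗Q x) (eval-scale (- 1ℚ) Q x)) (cancel (eval Q x)))
  coeff-P-Q≡0 : coeff P k + - 1ℚ * coeff Q k ≡ 0ℚ
  coeff-P-Q≡0 = trans (sym (trans (coeff-add P _ k) (cong (coeff P k +_) (coeff-scale (- 1ℚ) Q k))))
                      (eval≗0⇒AllCoeffsZero P-Q P-Q≗0 k)

HasDegree-≗ : eval P ≗ eval Q → HasDegree P d → HasDegree Q d
HasDegree-≗ {P} {Q} {d} P≗Q P° = hasDegree
  (leading≢0 P° ∘ trans (P≡Q d))
  (degreeAtMost λ k d<k → trans (sym (P≡Q k)) (vanish (atMost P°) k d<k))
  where P≡Q = eval≗⇒coeff≡ P Q P≗Q

linearProduct : (s : ℕ) → (Fin s → ℚ) → Poly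
linearProduct zero    r = 1ℚ ∷ []
linearProduct (suc s) r = mul (- r Fin.zero ∷ 1ℚ ∷ []) (linearProduct s (r ∘ Fin.suc))

eval-linearProduct : ∀ s r x → eval (linearProduct s r) x ≡ prod s (λ i → x - r i)
eval-linearProduct zero    r x = trans (cong (1ℚ +_) (*-zeroʳ x)) (+-identityʳ 1ℚ)
eval-linearProduct (suc s) r x =
  trans (eval-mul (- r Fin.zero ∷ 1ℚ ∷ []) (linearProduct s (r ∘ Fin.suc)) x)
        (cong₂ _*_ (lemma (r Fin.zero) x) (eval-linearProduct s (r ∘ Fin.suc) x))
  where
  lemma : ∀ r x → - r + x * (1ℚ + x * 0ℚ) ≡ x - r
  lemma = solve-∀ ℚ-ring

HasDegree-linearProduct : ∀ s r → HasDegree (linearProduct s r) s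
HasDegree-linearProduct zero    r = HasDegree-const 1≢0
HasDegree-linearProduct (suc s) r =
  HasDegree-mul (HasDegree-∷ (HasDegree-const 1≢0)) (HasDegree-linearProduct s (r ∘ Fin.suc))

prod-zero : ∀ s (h : Fin s → ℚ) i → h i ≡ 0ℚ → prod s h ≡ 0ℚ
prod-zero (suc s) h Fin.zero    hᵢ≡0 = trans (cong (_* prod s (h ∘ Fin.suc)) hᵢ≡0) (*-zeroˡ (prod s (h ∘ Fin.suc)))
prod-zero (suc s) h (Fin.suc i) hᵢ≡0 = trans (cong (h Fin.zero *_) (prod-zero s (h ∘ Fin.suc) i hᵢ≡0)) (*-zeroʳ (h Fin.zero))

prod≡0⇒factor≡0 : ∀ s (h : Fin s → ℚ) → prod s h ≡ 0ℚ → ∃ λ i → h i ≡ 0ℚ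
prod≡0⇒factor≡0 (suc s) h Πh≡0 with x*y≡0⇒x≡0⊎y≡0 Πh≡0
... | inj₁ h₀≡0 = Fin.zero , h₀≡0
... | inj₂ Π≡0  = let i , hᵢ≡0 = prod≡0⇒factor≡0 s (h ∘ Fin.suc) Π≡0 in Fin.suc i , hᵢ≡0

SimpleRationalRoots⇒Witnesses : ∀ P → SimpleRationalRoots P → HasDegree P (deg P) × Witnesses (Root P) (deg P)
SimpleRationalRoots⇒Witnesses P (c , c≢0 , s , r , r-inj , P≗cΠ) =
  subst (λ d → HasDegree P d × Witnesses (Root P) d) (sym (HasDegree⇒deg≡ P°)) (P° , witnesses r r-inj rootₖ)
  where
  P° : HasDegree P s
  P° = HasDegree-≗ (λ x → trans (eval-scale c (linearProduct s r) x)
                              (trans (cong (c *_) (eval-linearProduct s r x)) (sym (P≗cΠ x))))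
                   (HasDegree-scale c≢0 (HasDegree-linearProduct s r))
  rootₖ : ∀ k → Root P (r k)
  rootₖ k = trans (P≗cΠ (r k)) (trans (cong (c *_) (prod-zero s _ k (+-inverseʳ (r k)))) (*-zeroʳ c))

Witnesses⇒SimpleRationalRoots : HasDegree P d → Witnesses (Root P) d → SimpleRationalRoots P
Witnesses⇒SimpleRationalRoots {P} {d} P° W@(witnesses r r-inj _) =
  coeff P d , leading≢0 P° , d , r , r-inj , HasDegree-splits P° W

affine-injective : ∀ {k₁} k₀ → k₁ ≢ 0ℚ → Injective _≡_ _≡_ (λ x → k₁ * x + k₀)
affine-injective {k₁} k₀ k₁≢0 {x} {y} e = x∙y⁻¹≈ε⇒x≈y x y (x*y≡0⇒y≡0 k₁≢0 (begin
  k₁ * (x - y)                      ≡⟨ lemma k₁ x y k₀ ⟩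
  (k₁ * x + k₀) - (k₁ * y + k₀)     ≡⟨ cong (_- (k₁ * y + k₀)) e ⟩
  (k₁ * y + k₀) - (k₁ * y + k₀)     ≡⟨ +-inverseʳ (k₁ * y + k₀) ⟩
  0ℚ                                ∎))
  where
  open ≡-Reasoning
  lemma : ∀ k x y c → k * (x - y) ≡ (k * x + c) - (k * y + c)
  lemma = solve-∀ ℚ-ring

record Reparametrisation (f h : ℚ → ℚ) (s : ℕ) : Set where
  field
    slope intercept : ℚ
    slope≢0         : slope ≢ 0ℚ
    transforms      : ∀ x → f (slope * x + intercept) ≡ h x
    zeros           : Witnesses (Zero h) s

reparametrise : ∀ (f h : ℚ → ℚ) {k₁} k₀ → k₁ ≢ 0ℚ → (∀ x → f x ≡ h (k₁ * x + k₀)) → ∀ {s} → Witnesses (Zero f) s →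
  Reparametrisation f h s
reparametrise f h {k₁} k₀ k₁≢0 f≗h∘κ W = record
  { slope = k₁⁻¹ ; intercept = - (k₁⁻¹ * k₀) ; slope≢0 = 1/-≢0 k₁ ; transforms = f∘κ⁻¹≗h
  ; zeros = Witnesses-image (λ x → k₁ * x + k₀) (λ _ _ → affine-injective k₀ k₁≢0) (λ fx≡0 → trans (sym (f≗h∘κ _)) fx≡0) W
  }
  where
  instance _ = ≢-nonZero k₁≢0
  k₁⁻¹ = 1/ k₁
  f∘κ⁻¹≗h : ∀ x → f (k₁⁻¹ * x + - (k₁⁻¹ * k₀)) ≡ h x
  f∘κ⁻¹≗h x = trans (f≗h∘κ _) (cong h (begin
    k₁ * (k₁⁻¹ * x + - (k₁⁻¹ * k₀)) + k₀  ≡⟨ lemma k₁ k₁⁻¹ x k₀ ⟩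
    (k₁ * k₁⁻¹) * (x - k₀) + k₀        ≡⟨ cong (λ t → t * (x - k₀) + k₀) (*-inverseʳ k₁) ⟩
    1ℚ * (x - k₀) + k₀                 ≡⟨ lemma′ x k₀ ⟩
    x                                  ∎))
    where
    open ≡-Reasoning
    lemma : ∀ k a x c → k * (a * x + - (a * c)) + c ≡ (k * a) * (x - c) + c
    lemma = solve-∀ ℚ-ring
    lemma′ : ∀ x c → 1ℚ * (x - c) + c ≡ x
    lemma′ = solve-∀ ℚ-ring

HasDegree-affine : ∀ {k₁} k₀ → k₁ ≢ 0ℚ → HasDegree (k₀ ∷ k₁ ∷ []) 1
HasDegree-affine k₀ k₁≢0 = HasDegree-∷ (HasDegree-const k₁≢0)

eval-affine : ∀ k₁ k₀ x → eval (k₀ ∷ k₁ ∷ []) x ≡ k₁ * x + k₀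
eval-affine = lemma
  where
  lemma : ∀ k₁ k₀ x → k₀ + x * (k₁ + x * 0ℚ) ≡ k₁ * x + k₀
  lemma = solve-∀ ℚ-ring

HasDegree-∘-affine : ∀ {φ F m e k₁} f k₀ → HasDegree φ m → HasDegree F (suc e) → k₁ ≢ 0ℚ →
  (∀ x → eval f x ≡ eval φ (eval F (k₁ * x + k₀))) → HasDegree f (m ℕ.* suc e)
HasDegree-∘-affine {φ} {F} {m} {e} {k₁} f k₀ φ° F° k₁≢0 f≗ =
  subst (HasDegree f) (cong (m ℕ.*_) (cong suc (ℕ.*-identityʳ e)))
    (HasDegree-≗ φ∘F∘κ≗f (HasDegree-comp φ° (HasDegree-comp F° (HasDegree-affine k₀ k₁≢0))))
  where
  φ∘F∘κ≗f : ∀ x → eval (comp φ (comp F (k₀ ∷ k₁ ∷ []))) x ≡ eval f x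
  φ∘F∘κ≗f x = begin
    eval (comp φ (comp F (k₀ ∷ k₁ ∷ []))) x     ≡⟨ eval-comp φ _ x ⟩
    eval φ (eval (comp F (k₀ ∷ k₁ ∷ [])) x)     ≡⟨ cong (eval φ) (eval-comp F _ x) ⟩
    eval φ (eval F (eval (k₀ ∷ k₁ ∷ []) x))     ≡⟨ cong (eval φ ∘ eval F) (eval-affine k₁ k₀ x) ⟩
    eval φ (eval F (k₁ * x + k₀))               ≡⟨ sym (f≗ x) ⟩
    eval f x                                    ∎
    where open ≡-Reasoning

eval-subConst : ∀ G c y → eval (subConst G c) y ≡ eval G y - c
eval-subConst []      c y = trans (cong ((0ℚ - c) +_) (*-zeroʳ y)) (+-identityʳ _)
eval-subConst (a ∷ G) c y = lemma a c y (eval G y)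
  where
  lemma : ∀ a c y v → (a - c) + y * v ≡ (a + y * v) - c
  lemma = solve-∀ ℚ-ring

HasDegree-subConst : ∀ {G n} c → HasDegree G (suc n) → HasDegree (subConst G c) (suc n)
HasDegree-subConst {[]}    c G° = ⊥-elim (leading≢0 G° refl)
HasDegree-subConst {a ∷ G} c G° = hasDegree (leading≢0 G°) (DegreeAtMost-∷ (DegreeAtMost-tail (atMost G°)))

-- Every zero of gt is a zero of some G₀ - pᵢ, which has at most n of them; as gt has s * n
-- zeros, each G₀ - pᵢ has exactly n, so it splits with simple rational roots.
PTE-intro : ∀ {G₀ n s c} (gt : ℚ → ℚ) (p : Fin s → ℚ) → HasDegree G₀ (suc n) → Injective _≡_ _≡_ p → c ≢ 0ℚ →
  (∀ y → gt y ≡ c * prod s (λ i → eval G₀ y - p i)) → Witnesses (Zero gt) (s ℕ.* suc n) →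
  PTE (suc n) s (λ i → subConst G₀ (p i))
PTE-intro {G₀} {n} {s} {c} gt p G₀° p-inj c≢0 gt≗ W = H-simple , H-differences
  where
  H : Fin s → Poly
  H i = subConst G₀ (p i)
  H° : ∀ i → HasDegree (H i) (suc n)
  H° i = HasDegree-subConst (p i) G₀°
  covered : Zero gt ⊆ ⋃ (Fin s) (Root ∘ H)
  covered {y} gty≡0 =
    let i , G₀y-pᵢ≡0 = prod≡0⇒factor≡0 s _ (x*y≡0⇒y≡0 c≢0 (trans (sym (gt≗ y)) gty≡0))
    in i , trans (eval-subConst G₀ (p i) y) G₀y-pᵢ≡0
  H-roots : ∀ i → Witnesses (Root (H i)) (suc n)
  H-roots = Witnesses-⋃ (λ i y → eval (H i) y ≟ 0ℚ) (roots-AtMost ∘ H°) (Witnesses-mono covered W)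
  H-simple : ∀ i → ¬ IsZeroPoly (H i) × deg (H i) ≡ suc n × SimpleRationalRoots (H i)
  H-simple i = HasDegree⇒nonZero (H° i) , HasDegree⇒deg≡ (H° i) , Witnesses⇒SimpleRationalRoots (H° i) (H-roots i)
  H-differences : ∀ i j → i ≢ j → Σ ℚ λ c → c ≢ 0ℚ × (∀ x → eval (H i) x - eval (H j) x ≡ c)
  H-differences i j i≢j = p j - p i , x≢y⇒x-y≢0 (i≢j ∘ sym ∘ p-inj) , λ x →
    trans (cong₂ _-_ (eval-subConst G₀ (p i) x) (eval-subConst G₀ (p j) x)) (lemma (eval G₀ x) (p i) (p j))
    where
    lemma : ∀ g a b → (g - a) - (g - b) ≡ b - a
    lemma = solve-∀ ℚ-ring

-- A root of ψ has at most one positive and one non-positive (k + 1)-th root.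
module _ {ψ m} (ψ° : HasDegree ψ m) (k : ℕ) where

  positive-power-roots-AtMost : AtMost ((0ℚ <_) ∩ (λ x → Root ψ (x ^ suc k))) m
  positive-power-roots-AtMost = AtMost-preimage (_^ suc k)
    (λ (0<x , _) (0<y , _) → ^-injective-nonNeg k (<⇒≤ 0<x) (<⇒≤ 0<y)) proj₂ (roots-AtMost ψ°)

  nonPositive-power-roots-AtMost : AtMost (∁ (0ℚ <_) ∩ (λ x → Root ψ (x ^ suc k))) m
  nonPositive-power-roots-AtMost = AtMost-preimage (_^ suc k)
    (λ (0≮x , _) (0≮y , _) → ^-injective-nonPos k (≮⇒≥ 0≮x) (≮⇒≥ 0≮y)) proj₂ (roots-AtMost ψ°)

  power-roots-AtMost : AtMost (λ x → Root ψ (x ^ suc k)) (m ℕ.+ m)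
  power-roots-AtMost = AtMost-split (0ℚ <?_) positive-power-roots-AtMost nonPositive-power-roots-AtMost

  positive-power-roots : Witnesses (λ x → Root ψ (x ^ suc k)) (m ℕ.+ m) →
    Witnesses ((0ℚ <_) ∩ (λ x → Root ψ (x ^ suc k))) m
  positive-power-roots =
    proj₁ ∘ Witnesses-split (0ℚ <?_) positive-power-roots-AtMost nonPositive-power-roots-AtMost

prod-cong : ∀ s {h h′ : Fin s → ℚ} → (∀ i → h i ≡ h′ i) → prod s h ≡ prod s h′
prod-cong zero    _    = refl
prod-cong (suc s) h≗h′ = cong₂ _*_ (h≗h′ Fin.zero) (prod-cong s (h≗h′ ∘ Fin.suc))

case1-intro : ∀ {degf degg ft gt ψ G₀ m n} → HasDegree ψ m → HasDegree G₀ n → 1 ℕ.≤ n →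
  (∀ x → ft x ≡ eval ψ x) → (∀ y → gt y ≡ eval ψ (eval G₀ y)) →
  Witnesses (Root ψ) m → Witnesses (Root ψ ∘ eval G₀) (m ℕ.* n) → degf ∣ degg → Case1 degf degg ft gt
case1-intro {ft = ft} {gt} {ψ} {G₀} {m} {suc n} ψ° G₀° 1≤n ft≗ gt≗ ψ-roots ψ∘G₀-roots degf∣degg =
    degf∣degg , G₀ , suc n , coeff ψ m , m , p
  , HasDegree⇒nonZero G₀° , HasDegree⇒deg≡ G₀° , 1≤n , leading≢0 ψ° , Witnesses.point-injective ψ-roots
  , ft-form , gt-form
  , PTE-intro (eval ψ ∘ eval G₀) p G₀° (Witnesses.point-injective ψ-roots) (leading≢0 ψ°) (ψ-splits ∘ eval G₀) ψ∘G₀-roots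
  , λ X → trans (ft≗ _) (sym (gt≗ _))
  where
  p = Witnesses.point ψ-roots
  ψ-splits = HasDegree-splits ψ° ψ-roots
  ft-form : ∀ x → ft x ≡ coeff ψ m * prod m (λ i → x - p i)
  ft-form x = trans (ft≗ x) (ψ-splits x)
  gt-form : ∀ y → gt y ≡ coeff ψ m * prod m (λ i → eval G₀ y - p i)
  gt-form y = trans (gt≗ y) (ψ-splits (eval G₀ y))

-- The 2m zeros of ψ(x²) come in m pairs ±qᵢ with qᵢ > 0, and the qᵢ² are the m roots of ψ.
case2-intro : ∀ {degf degg ft gt ψ G₀ m n} → HasDegree ψ m → HasDegree G₀ n → 1 ℕ.≤ n →
  (∀ x → ft x ≡ eval ψ (x ^ 2)) → (∀ y → gt y ≡ eval ψ (eval G₀ y)) →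
  Witnesses (λ x → Root ψ (x ^ 2)) (m ℕ.+ m) → Witnesses (Root ψ ∘ eval G₀) (m ℕ.* n) → AtMostTwoOddRoots G₀ →
  InfManyBoundedDenom (λ x y → x ^ 2 ≡ eval G₀ y × ft x ≡ gt y) → degf ∣ 2 ℕ.* degg → Case2 degf degg ft gt
case2-intro {ft = ft} {gt} {ψ} {G₀} {m} {suc n} ψ° G₀° 1≤n ft≗ gt≗ ψ∘x²-roots ψ∘G₀-roots G₀-odd infinitely-many degf∣2degg =
    degf∣2degg , G₀ , suc n , coeff ψ m , m , q
  , HasDegree⇒nonZero G₀° , HasDegree⇒deg≡ G₀° , 1≤n , leading≢0 ψ° , Witnesses.point-injective square-roots
  , proj₁ ∘ Witnesses.satisfies square-roots
  , ft-form , gt-form , G₀-odd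
  , PTE-intro (eval ψ ∘ eval G₀) (λ i → q i ^ 2) G₀° (Witnesses.point-injective ψ-roots) (leading≢0 ψ°)
      (ψ-splits ∘ eval G₀) ψ∘G₀-roots
  , infinitely-many
  where
  square-roots : Witnesses ((0ℚ <_) ∩ (λ x → Root ψ (x ^ 2))) m
  square-roots = positive-power-roots ψ° 1 ψ∘x²-roots
  q = Witnesses.point square-roots
  ψ-roots : Witnesses (Root ψ) m
  ψ-roots = Witnesses-image (_^ 2) (λ (0<x , _) (0<y , _) → ^-injective-nonNeg 1 (<⇒≤ 0<x) (<⇒≤ 0<y)) proj₂ square-roots
  ψ-splits : ∀ t → eval ψ t ≡ coeff ψ m * prod m (λ i → t - q i ^ 2)
  ψ-splits = HasDegree-splits ψ° ψ-roots
  difference-of-squares : ∀ x q → x ^ 2 - q ^ 2 ≡ (x - q) * (x + q)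
  difference-of-squares = lemma
    where
    lemma : ∀ x q → x * (x * 1ℚ) - q * (q * 1ℚ) ≡ (x - q) * (x + q)
    lemma = solve-∀ ℚ-ring
  ft-form : ∀ x → ft x ≡ coeff ψ m * prod m (λ i → (x - q i) * (x + q i))
  ft-form x = trans (ft≗ x) (trans (ψ-splits (x ^ 2)) (cong (coeff ψ m *_) (prod-cong m (difference-of-squares x ∘ q))))
  gt-form : ∀ y → gt y ≡ coeff ψ m * prod m (λ i → eval G₀ y - q i ^ 2)
  gt-form y = trans (gt≗ y) (ψ-splits (eval G₀ y))

-- Standard pairs

X^ : ℕ → Poly
X^ zero    = 1ℚ ∷ []
X^ (suc p) = 0ℚ ∷ X^ p

eval-X^ : ∀ p x → eval (X^ p) x ≡ x ^ p
eval-X^ zero    x = trans (cong (1ℚ +_) (*-zeroʳ x)) (+-identityʳ 1ℚ)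
eval-X^ (suc p) x = trans (+-identityˡ _) (cong (x *_) (eval-X^ p x))

HasDegree-X^ : ∀ p → HasDegree (X^ p) p
HasDegree-X^ zero    = HasDegree-const 1≢0
HasDegree-X^ (suc p) = HasDegree-∷ (HasDegree-X^ p)

infixr 8 _^ᴾ_
_^ᴾ_ : Poly → ℕ → Poly
v ^ᴾ zero  = 1ℚ ∷ []
v ^ᴾ suc q = mul v (v ^ᴾ q)

eval-^ᴾ : ∀ v q x → eval (v ^ᴾ q) x ≡ eval v x ^ q
eval-^ᴾ v zero    x = eval-X^ 0 x
eval-^ᴾ v (suc q) x = trans (eval-mul v (v ^ᴾ q) x) (cong (eval v x *_) (eval-^ᴾ v q x))

HasDegree-^ᴾ : ∀ {v d} q → HasDegree v d → HasDegree (v ^ᴾ q) (q ℕ.* d)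
HasDegree-^ᴾ zero    v° = HasDegree-const 1≢0
HasDegree-^ᴾ (suc q) v° = HasDegree-mul v° (HasDegree-^ᴾ q v°)

quadratic : ℚ → ℚ → Poly
quadratic α β = β ∷ 0ℚ ∷ α ∷ []

eval-quadratic : ∀ α β x → eval (quadratic α β) x ≡ α * x ^ 2 + β
eval-quadratic = lemma
  where
  lemma : ∀ α β x → β + x * (0ℚ + x * (α + x * 0ℚ)) ≡ α * (x * (x * 1ℚ)) + β
  lemma = solve-∀ ℚ-ring

HasDegree-quadratic : ∀ {α} β → α ≢ 0ℚ → HasDegree (quadratic α β) 2
HasDegree-quadratic β α≢0 = HasDegree-∷ (HasDegree-∷ (HasDegree-const α≢0))

monomial-degree : ∀ {F} q → (∀ x → eval F x ≡ x ^ q) → HasDegree F q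
monomial-degree q F≗ = HasDegree-≗ (λ x → trans (eval-X^ q x) (sym (F≗ x))) (HasDegree-X^ q)

first-kind-degree : ∀ {G α v d} p q → α ≢ 0ℚ → HasDegree v d →
  (∀ x → eval G x ≡ α * x ^ p * eval v x ^ q) → HasDegree G (p ℕ.+ q ℕ.* d)
first-kind-degree {G} {α} {v} p q α≢0 v° G≗ =
  HasDegree-≗ rep≗G (HasDegree-scale α≢0 (HasDegree-mul (HasDegree-X^ p) (HasDegree-^ᴾ q v°)))
  where
  rep≗G : ∀ x → eval (scale α (mul (X^ p) (v ^ᴾ q))) x ≡ eval G x
  rep≗G x = begin
    eval (scale α (mul (X^ p) (v ^ᴾ q))) x  ≡⟨ eval-scale α (mul (X^ p) (v ^ᴾ q)) x ⟩
    α * eval (mul (X^ p) (v ^ᴾ q)) x        ≡⟨ cong (α *_) (eval-mul (X^ p) (v ^ᴾ q) x) ⟩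
    α * (eval (X^ p) x * eval (v ^ᴾ q) x)   ≡⟨ cong₂ (λ a b → α * (a * b)) (eval-X^ p x) (eval-^ᴾ v q x) ⟩
    α * (x ^ p * eval v x ^ q)              ≡⟨ sym (*-assoc α _ _) ⟩
    α * x ^ p * eval v x ^ q                ≡⟨ sym (G≗ x) ⟩
    eval G x                                ∎
    where open ≡-Reasoning

second-kind-degree : ∀ {G α β v d} → α ≢ 0ℚ → HasDegree v d →
  (∀ x → eval G x ≡ (α * x ^ 2 + β) * eval v x ^ 2) → HasDegree G (2 ℕ.+ 2 ℕ.* d)
second-kind-degree {G} {α} {β} {v} α≢0 v° G≗ =
  HasDegree-≗ rep≗G (HasDegree-mul (HasDegree-quadratic β α≢0) (HasDegree-^ᴾ 2 v°))
  where
  rep≗G : ∀ x → eval (mul (quadratic α β) (v ^ᴾ 2)) x ≡ eval G x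
  rep≗G x = trans (eval-mul (quadratic α β) (v ^ᴾ 2) x)
                  (trans (cong₂ _*_ (eval-quadratic α β x) (eval-^ᴾ v 2 x)) (sym (G≗ x)))

AtMostTwoOddRoots-intro : ∀ {G h d} w → HasDegree h d → d ℕ.≤ 2 →
  (∀ y → eval G y ≡ eval h y * eval w y ^ 2) → AtMostTwoOddRoots G
AtMostTwoOddRoots-intro {h = h} w h° d≤2 G≗ =
  h , w , HasDegree⇒nonZero h° , subst (ℕ._≤ 2) (sym (HasDegree⇒deg≡ h°)) d≤2 , G≗

record LinearReduction (F G : Poly) : Set where
  field
    F-degree : HasDegree F 1
    n        : ℕ
    G-degree : HasDegree G (suc n)

record QuadraticReduction (F G : Poly) : Set where
  field
    γ δ         : ℚ
    γ≢0         : γ ≢ 0ℚ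
    G₀          : Poly
    n           : ℕ
    G₀-degree   : HasDegree G₀ (suc n)
    G₀-oddRoots : AtMostTwoOddRoots G₀
    F-form      : ∀ x → eval F x ≡ γ * x ^ 2 + δ
    G-form      : ∀ y → eval G y ≡ γ * eval G₀ y + δ

HighPower : Poly → Set
HighPower H = Σ ℕ λ q → ∀ x → eval H x ≡ x ^ (3 ℕ.+ q)

data Shape (F G : Poly) : Set where
  F-linear     : LinearReduction F G → Shape F G
  F-quadratic  : QuadraticReduction F G → Shape F G
  F-high-power : HighPower F → Shape F G
  G-high-power : HighPower G → Shape F G

DegreeOrdered : Poly → Poly → Set
DegreeOrdered F G = ∀ {d e} → HasDegree F (suc d) → HasDegree G (suc e) → d ℕ.≤ e

private
  t≡1*t+0 : ∀ t → t ≡ 1ℚ * t + 0ℚ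
  t≡1*t+0 = solve-∀ ℚ-ring

  square-reduction : ∀ {F G} n G₀-degree G₀-oddRoots → (∀ x → eval F x ≡ x ^ 2) → QuadraticReduction F G
  square-reduction {F} {G} n G₀-degree G₀-oddRoots F≗ = record
    { γ = 1ℚ ; δ = 0ℚ ; γ≢0 = 1≢0 ; G₀ = G ; n = n ; G₀-degree = G₀-degree ; G₀-oddRoots = G₀-oddRoots
    ; F-form = λ x → trans (F≗ x) (t≡1*t+0 (x ^ 2))
    ; G-form = λ y → t≡1*t+0 (eval G y)
    }

first-kind-shape : ∀ {F G} → StdFirstOrdered F G → Shape F G
first-kind-shape (_ , 0 , _ , _ , _ , () , _)
first-kind-shape (α , 1 , 0 , v , α≢0 , _ , _ , _ , v≢0 , 0<deg-v , F≗ , G≗)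
  with deg v | nonZero⇒HasDegree v v≢0 | 0<deg-v
... | suc dv | v° | _ = F-linear (record
  { F-degree = monomial-degree 1 F≗ ; n = dv ℕ.+ 0 ; G-degree = first-kind-degree 0 1 α≢0 v° G≗ })
first-kind-shape (_ , 1 , suc _ , _ , _ , _ , s≤s () , _)
first-kind-shape (_ , 2 , 0 , _ , _ , _ , _ , () , _)
first-kind-shape {G = G} (α , 2 , 1 , v , α≢0 , _ , _ , _ , v≢0 , _ , F≗ , G≗) = F-quadratic
  (square-reduction (2 ℕ.* deg v) (first-kind-degree 1 2 α≢0 (nonZero⇒HasDegree v v≢0) G≗)
    (AtMostTwoOddRoots-intro {G} v (HasDegree-affine 0ℚ α≢0) (s≤s z≤n) G≡αx*v²) F≗)
  where
  lemma : ∀ α y w → α * (y * 1ℚ) * w ≡ (α * y + 0ℚ) * w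
  lemma = solve-∀ ℚ-ring
  G≡αx*v² : ∀ y → eval G y ≡ eval (0ℚ ∷ α ∷ []) y * eval v y ^ 2
  G≡αx*v² y = trans (G≗ y) (trans (lemma α y (eval v y ^ 2)) (cong (_* eval v y ^ 2) (sym (eval-affine α 0ℚ y))))
first-kind-shape (_ , 2 , suc (suc _) , _ , _ , _ , s≤s (s≤s ()) , _)
first-kind-shape (_ , suc (suc (suc q)) , _ , _ , _ , _ , _ , _ , _ , _ , F≗ , _) = F-high-power (q , F≗)

-- For q ≤ 2, deg F ≤ deg G = q forces F to be linear.
first-kind-swapped-shape : ∀ {F G} → StdFirstOrdered G F → DegreeOrdered F G → Shape F G
first-kind-swapped-shape (_ , 0 , _ , _ , _ , () , _) _
first-kind-swapped-shape {F} (α , 1 , 0 , v , α≢0 , _ , _ , _ , v≢0 , 0<deg-v , G≗ , F≗) F≤G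
  with deg v | nonZero⇒HasDegree v v≢0 | 0<deg-v
... | suc dv | v° | _ = F-linear (record
  { F-degree = subst (λ d → HasDegree F (suc d)) (ℕ.n≤0⇒n≡0 (F≤G F° G°)) F° ; n = 0 ; G-degree = G° })
  where
  F° = first-kind-degree 0 1 α≢0 v° F≗
  G° = monomial-degree 1 G≗
first-kind-swapped-shape (_ , 1 , suc _ , _ , _ , _ , s≤s () , _) _
first-kind-swapped-shape (_ , 2 , 0 , _ , _ , _ , _ , () , _) _
first-kind-swapped-shape (α , 2 , 1 , v , α≢0 , _ , _ , _ , v≢0 , _ , G≗ , F≗) F≤G
  with deg v | nonZero⇒HasDegree v v≢0
... | zero   | v° = F-linear (record
  { F-degree = first-kind-degree 1 2 α≢0 v° F≗ ; n = 1 ; G-degree = monomial-degree 2 G≗ })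
... | suc dv | v° = ⊥-elim (2*[1+dv]≰1 (F≤G (first-kind-degree 1 2 α≢0 v° F≗) (monomial-degree 2 G≗)))
  where
  2*[1+dv]≰1 : ¬ (2 ℕ.* suc dv ℕ.≤ 1)
  2*[1+dv]≰1 (s≤s dv+[1+dv]≤0) = ℕ.m+1+n≢0 dv (ℕ.n≤0⇒n≡0 dv+[1+dv]≤0)
first-kind-swapped-shape (_ , 2 , suc (suc _) , _ , _ , _ , s≤s (s≤s ()) , _) _
first-kind-swapped-shape (_ , suc (suc (suc q)) , _ , _ , _ , _ , _ , _ , _ , _ , G≗ , _) _ = G-high-power (q , G≗)

second-kind-shape : ∀ {F G} → StdSecondOrdered F G → Shape F G
second-kind-shape {G = G} (α , β , v , α≢0 , _ , v≢0 , F≗ , G≗) = F-quadratic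
  (square-reduction (1 ℕ.+ 2 ℕ.* deg v) (second-kind-degree α≢0 (nonZero⇒HasDegree v v≢0) G≗)
    (AtMostTwoOddRoots-intro {G} v (HasDegree-quadratic β α≢0) ℕ.≤-refl
      (λ y → trans (G≗ y) (cong (_* eval v y ^ 2) (sym (eval-quadratic α β y)))))
    F≗)

-- deg F ≤ deg G = 2 forces v to be a constant v₀; then G = γ G₀ + δ with G₀ = (x² - δ) / γ.
second-kind-swapped-shape : ∀ {F G} → StdSecondOrdered G F → DegreeOrdered F G → Shape F G
second-kind-swapped-shape {F} {G} (α , β , v , α≢0 , _ , v≢0 , G≗ , F≗) F≤G
  with deg v | nonZero⇒HasDegree v v≢0
... | suc dv | v° = ⊥-elim (F-degree≰2 (F≤G (second-kind-degree α≢0 v° F≗) (monomial-degree 2 G≗)))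
  where
  F-degree≰2 : ∀ {n} → suc (suc n) ℕ.≤ 1 → ⊥
  F-degree≰2 (s≤s ())
... | zero   | v° = F-quadratic (record
  { γ = γ ; δ = δ ; γ≢0 = γ≢0 ; G₀ = G₀ ; n = 1 ; G₀-degree = G₀°
  ; G₀-oddRoots = AtMostTwoOddRoots-intro {G₀} (1ℚ ∷ []) G₀° ℕ.≤-refl (λ y → times-1² (eval G₀ y) y)
  ; F-form = F-form ; G-form = G-form
  })
  where
  open ≡-Reasoning
  v₀ = coeff v 0
  γ = α * v₀ ^ 2
  δ = β * v₀ ^ 2
  γ≢0 : γ ≢ 0ℚ
  γ≢0 = *-≢0 α≢0 (^-≢0 2 (leading≢0 v°))
  instance _ = ≢-nonZero γ≢0
  G₀ = quadratic (1/ γ) (- (δ * 1/ γ))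
  G₀° : HasDegree G₀ 2
  G₀° = HasDegree-quadratic (- (δ * 1/ γ)) (1/-≢0 γ)
  times-1² : ∀ g y → g ≡ g * ((1ℚ + y * 0ℚ) * ((1ℚ + y * 0ℚ) * 1ℚ))
  times-1² = solve-∀ ℚ-ring
  distribute : ∀ α X β C → (α * X + β) * C ≡ (α * C) * X + β * C
  distribute = solve-∀ ℚ-ring
  F-form : ∀ x → eval F x ≡ γ * x ^ 2 + δ
  F-form x = begin
    eval F x                           ≡⟨ F≗ x ⟩
    (α * x ^ 2 + β) * eval v x ^ 2     ≡⟨ cong (λ t → (α * x ^ 2 + β) * t ^ 2) (eval-const (atMost v°) x) ⟩
    (α * x ^ 2 + β) * v₀ ^ 2           ≡⟨ distribute α (x ^ 2) β (v₀ ^ 2) ⟩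
    γ * x ^ 2 + δ                      ∎
  expand : ∀ γ γ⁻¹ Y δ → γ * (γ⁻¹ * Y + - (δ * γ⁻¹)) + δ ≡ (γ * γ⁻¹) * Y + (1ℚ - γ * γ⁻¹) * δ
  expand = solve-∀ ℚ-ring
  collapse : ∀ Y δ → 1ℚ * Y + (1ℚ - 1ℚ) * δ ≡ Y
  collapse = solve-∀ ℚ-ring
  G-form : ∀ y → eval G y ≡ γ * eval G₀ y + δ
  G-form y = sym (begin
    γ * eval G₀ y + δ                                  ≡⟨ cong (λ t → γ * t + δ) (eval-quadratic (1/ γ) (- (δ * 1/ γ)) y) ⟩
    γ * (1/ γ * y ^ 2 + - (δ * 1/ γ)) + δ              ≡⟨ expand γ (1/ γ) (y ^ 2) δ ⟩
    (γ * 1/ γ) * y ^ 2 + (1ℚ - γ * 1/ γ) * δ           ≡⟨ cong (λ t → t * y ^ 2 + (1ℚ - t) * δ) (*-inverseʳ γ) ⟩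
    1ℚ * y ^ 2 + (1ℚ - 1ℚ) * δ                         ≡⟨ collapse (y ^ 2) δ ⟩
    y ^ 2                                              ≡⟨ sym (G≗ y) ⟩
    eval G y                                           ∎)

standard-pair-shape : ∀ {F G} → StandardPair1or2 F G → DegreeOrdered F G → Shape F G
standard-pair-shape (inj₁ first)                 _   = first-kind-shape first
standard-pair-shape (inj₂ (inj₁ first))          F≤G = first-kind-swapped-shape first F≤G
standard-pair-shape (inj₂ (inj₂ (inj₁ second)))  _   = second-kind-shape second
standard-pair-shape (inj₂ (inj₂ (inj₂ second)))  F≤G = second-kind-swapped-shape second F≤G

Conclusion : Poly → Poly → Set
Conclusion f g = Σ ℚ λ a → Σ ℚ λ b → Σ ℚ λ c → Σ ℚ λ d → a ≢ 0ℚ × c ≢ 0ℚ ×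
  (Case1 (deg f) (deg g) (λ x → eval f (a * x + b)) (λ y → eval g (c * y + d))
   ⊎ Case2 (deg f) (deg g) (λ x → eval f (a * x + b)) (λ y → eval g (c * y + d)))

InfManyBoundedDenom-map : ∀ {P Q : ℚ → ℚ → Set} → (∀ {x y} → P x y → Q x y) →
  InfManyBoundedDenom P → InfManyBoundedDenom Q
InfManyBoundedDenom-map P⇒Q (Δ , Δ≢0 , solutions) =
  Δ , Δ≢0 , λ L → let x , y , Pxy , rest = solutions L in x , y , P⇒Q Pxy , rest

m+m≡m*2 : ∀ m → m ℕ.+ m ≡ m ℕ.* 2
m+m≡m*2 m = sym (trans (ℕ.*-suc m 1) (cong (m ℕ.+_) (ℕ.*-identityʳ m)))

m*[3+q]≰m+m : ∀ m q → 1 ℕ.≤ m ℕ.* (3 ℕ.+ q) → ¬ (m ℕ.* (3 ℕ.+ q) ℕ.≤ m ℕ.+ m)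
m*[3+q]≰m+m zero    q ()
m*[3+q]≰m+m (suc m) q _ m*[3+q]≤m+m = 3+q≰2 (ℕ.*-cancelˡ-≤ (suc m) (subst (suc m ℕ.* (3 ℕ.+ q) ℕ.≤_) (m+m≡m*2 (suc m)) m*[3+q]≤m+m))
  where
  3+q≰2 : ¬ (3 ℕ.+ q ℕ.≤ 2)
  3+q≰2 (s≤s (s≤s ()))

module Decomposition
  (f g φ F G : Poly) (k₁ k₀ l₁ l₀ : ℚ) (k₁≢0 : k₁ ≢ 0ℚ) (l₁≢0 : l₁ ≢ 0ℚ)
  (f≗ : ∀ x → eval f x ≡ eval φ (eval F (k₁ * x + k₀)))
  (g≗ : ∀ x → eval g x ≡ eval φ (eval G (l₁ * x + l₀)))
  (f-simple : SimpleRationalRoots f) (g-simple : SimpleRationalRoots g)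
  (1≤deg-f : 1 ℕ.≤ deg f) (1≤deg-g : 1 ℕ.≤ deg g) (deg-f≤deg-g : deg f ℕ.≤ deg g)
  (F=G-solutions : InfManyBoundedDenom (EqSol F G))
  where

  f-roots : Witnesses (Root f) (deg f)
  f-roots = proj₂ (SimpleRationalRoots⇒Witnesses f f-simple)

  g-roots : Witnesses (Root g) (deg g)
  g-roots = proj₂ (SimpleRationalRoots⇒Witnesses g g-simple)

  m : ℕ
  m = deg φ

  φ° : HasDegree φ m
  φ° with zero-or-HasDegree φ
  ... | inj₂ φ° = φ°
  ... | inj₁ φ≡0 = ⊥-elim (leading≢0 f° (eval≗0⇒AllCoeffsZero f f≗0 (deg f)))
    where
    f° = proj₁ (SimpleRationalRoots⇒Witnesses f f-simple)
    f≗0 : ∀ x → eval f x ≡ 0ℚ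
    f≗0 x = trans (f≗ x) (eval-AllCoeffsZero φ φ≡0 _)

  deg-f≡ : ∀ {d} → HasDegree F (suc d) → deg f ≡ m ℕ.* suc d
  deg-f≡ F° = HasDegree⇒deg≡ (HasDegree-∘-affine f k₀ φ° F° k₁≢0 f≗)

  deg-g≡ : ∀ {e} → HasDegree G (suc e) → deg g ≡ m ℕ.* suc e
  deg-g≡ G° = HasDegree⇒deg≡ (HasDegree-∘-affine g l₀ φ° G° l₁≢0 g≗)

  F≤G : DegreeOrdered F G
  F≤G {d} {e} F° G° = ℕ.≤-pred (ℕ.*-cancelˡ-≤ m {{m≢0}} (subst₂ ℕ._≤_ (deg-f≡ F°) (deg-g≡ G°) deg-f≤deg-g))
    where
    m≢0 : ℕ.NonZero m
    m≢0 = ℕ.≢-nonZero λ m≡0 → ℕ.1+n≰n {0} (subst (1 ℕ.≤_) (trans (deg-f≡ F°) (cong (ℕ._* suc d) m≡0)) 1≤deg-f)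

  -- h would have m (3 + q) distinct zeros, but φ(x^(3+q)) has at most m + m.
  high-power-impossible : ∀ h H {l₁} l₀ → l₁ ≢ 0ℚ → (∀ x → eval h x ≡ eval φ (eval H (l₁ * x + l₀))) →
    1 ℕ.≤ deg h → Witnesses (Root h) (deg h) → HighPower H → ⊥
  high-power-impossible h H l₀ l₁≢0 h≗ 1≤deg-h h-roots (q , H≗) =
    m*[3+q]≰m+m m q (subst (1 ℕ.≤_) deg-h≡ 1≤deg-h) (power-roots-AtMost φ° (2 ℕ.+ q) power-roots)
    where
    deg-h≡ : deg h ≡ m ℕ.* (3 ℕ.+ q)
    deg-h≡ = HasDegree⇒deg≡ (HasDegree-∘-affine h l₀ φ° (monomial-degree {H} (3 ℕ.+ q) H≗) l₁≢0 h≗)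
    power-roots : Witnesses (λ x → Root φ (x ^ (3 ℕ.+ q))) (m ℕ.* (3 ℕ.+ q))
    power-roots = subst (Witnesses _) deg-h≡ (Witnesses-mono (λ {x} → trans (cong (eval φ) (sym (H≗ x))))
      (Reparametrisation.zeros (reparametrise (eval h) (eval φ ∘ eval H) l₀ l₁≢0 h≗ h-roots)))

  open Reparametrisation

  g-change : Reparametrisation (eval g) (eval φ ∘ eval G) (deg g)
  g-change = reparametrise (eval g) (eval φ ∘ eval G) l₀ l₁≢0 g≗ g-roots

  linear-case : LinearReduction F G → Conclusion f g
  linear-case record { F-degree = F° ; n = n ; G-degree = G° } =
      slope f-change , intercept f-change , slope g-change , intercept g-change
    , slope≢0 f-change , slope≢0 g-change
    , inj₁ (case1-intro φ° G° (s≤s z≤n) (transforms f-change) (transforms g-change)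
             (subst (Witnesses _) deg-f≡m (zeros f-change)) (subst (Witnesses _) (deg-g≡ G°) (zeros g-change))
             (subst₂ _∣_ (sym deg-f≡m) (sym (deg-g≡ G°)) (m∣m*n (suc n))))
    where
    γ = coeff F 1
    δ = coeff F 0
    f≗φ∘κ : ∀ x → eval f x ≡ eval φ ((γ * k₁) * x + (γ * k₀ + δ))
    f≗φ∘κ x = trans (f≗ x) (cong (eval φ) (trans (eval-linear (atMost F°) _) (lemma γ k₁ x k₀ δ)))
      where
      lemma : ∀ γ k₁ x k₀ δ → γ * (k₁ * x + k₀) + δ ≡ (γ * k₁) * x + (γ * k₀ + δ)
      lemma = solve-∀ ℚ-ring
    f-change : Reparametrisation (eval f) (eval φ) (deg f)
    f-change = reparametrise (eval f) (eval φ) (γ * k₀ + δ) (*-≢0 (leading≢0 F°) k₁≢0) f≗φ∘κ f-roots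
    deg-f≡m : deg f ≡ m
    deg-f≡m = trans (deg-f≡ F°) (ℕ.*-identityʳ m)

  f-change : Reparametrisation (eval f) (eval φ ∘ eval F) (deg f)
  f-change = reparametrise (eval f) (eval φ ∘ eval F) k₀ k₁≢0 f≗ f-roots

  quadratic-case : QuadraticReduction F G → Conclusion f g
  quadratic-case r =
      slope f-change , intercept f-change , slope g-change , intercept g-change
    , slope≢0 f-change , slope≢0 g-change
    , inj₂ (case2-intro {degg = deg g} ψ° G₀-degree (s≤s z≤n) ft≗ψ∘x² gt≗ψ∘G₀
             (subst (Witnesses _) deg-f≡m+m (Witnesses-mono (λ {x} → trans (sym (φ∘F≗ψ∘x² x))) (zeros f-change)))
             (subst (Witnesses _) deg-g≡m*n (Witnesses-mono (λ {y} → trans (sym (φ∘G≗ψ∘G₀ y))) (zeros g-change)))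
             G₀-oddRoots
             (InfManyBoundedDenom-map solution F=G-solutions)
             (subst₂ _∣_ (sym deg-f≡m*2) (cong (2 ℕ.*_) (sym deg-g≡m*n)) (m*2∣2*[m*n] m (suc n))))
    where
    open QuadraticReduction r
    ψ : Poly
    ψ = comp φ (δ ∷ γ ∷ [])
    ψ° : HasDegree ψ m
    ψ° = subst (HasDegree ψ) (ℕ.*-identityʳ m) (HasDegree-comp φ° (HasDegree-affine δ γ≢0))
    eval-ψ : ∀ t → eval ψ t ≡ eval φ (γ * t + δ)
    eval-ψ t = trans (eval-comp φ (δ ∷ γ ∷ []) t) (cong (eval φ) (eval-affine γ δ t))
    φ∘F≗ψ∘x² : ∀ x → eval φ (eval F x) ≡ eval ψ (x ^ 2)
    φ∘F≗ψ∘x² x = trans (cong (eval φ) (F-form x)) (sym (eval-ψ (x ^ 2)))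
    φ∘G≗ψ∘G₀ : ∀ y → eval φ (eval G y) ≡ eval ψ (eval G₀ y)
    φ∘G≗ψ∘G₀ y = trans (cong (eval φ) (G-form y)) (sym (eval-ψ (eval G₀ y)))
    ft≗ψ∘x² : ∀ x → eval f (slope f-change * x + intercept f-change) ≡ eval ψ (x ^ 2)
    ft≗ψ∘x² x = trans (transforms f-change x) (φ∘F≗ψ∘x² x)
    gt≗ψ∘G₀ : ∀ y → eval g (slope g-change * y + intercept g-change) ≡ eval ψ (eval G₀ y)
    gt≗ψ∘G₀ y = trans (transforms g-change y) (φ∘G≗ψ∘G₀ y)
    F° : HasDegree F 2
    F° = HasDegree-≗ (λ x → trans (eval-quadratic γ δ x) (sym (F-form x))) (HasDegree-quadratic δ γ≢0)
    deg-f≡m*2 : deg f ≡ m ℕ.* 2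
    deg-f≡m*2 = deg-f≡ F°
    deg-f≡m+m : deg f ≡ m ℕ.+ m
    deg-f≡m+m = trans deg-f≡m*2 (sym (m+m≡m*2 m))
    deg-g≡m*n : deg g ≡ m ℕ.* suc n
    deg-g≡m*n = HasDegree⇒deg≡ (HasDegree-∘-affine g l₀ ψ° G₀-degree l₁≢0 (λ y → trans (g≗ y) (φ∘G≗ψ∘G₀ _)))
    solution : ∀ {x y} → EqSol F G x y →
      x ^ 2 ≡ eval G₀ y × eval f (slope f-change * x + intercept f-change) ≡ eval g (slope g-change * y + intercept g-change)
    solution {x} {y} Fx≡Gy =
        affine-injective δ γ≢0 (trans (sym (F-form x)) (trans Fx≡Gy (G-form y)))
      , trans (transforms f-change x) (trans (cong (eval φ) Fx≡Gy) (sym (transforms g-change y)))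
    m*2∣2*[m*n] : ∀ m n → m ℕ.* 2 ∣ 2 ℕ.* (m ℕ.* n)
    m*2∣2*[m*n] m n = subst (m ℕ.* 2 ∣_) (lemma m n) (m∣m*n n)
      where
      lemma : ∀ m n → m ℕ.* 2 ℕ.* n ≡ 2 ℕ.* (m ℕ.* n)
      lemma = ℕ-solve-∀

  conclusion : Shape F G → Conclusion f g
  conclusion (F-linear r)     = linear-case r
  conclusion (F-quadratic r)  = quadratic-case r
  conclusion (F-high-power h) = ⊥-elim (high-power-impossible f F k₀ k₁≢0 f≗ 1≤deg-f f-roots h)
  conclusion (G-high-power h) = ⊥-elim (high-power-impossible g G l₀ l₁≢0 g≗ 1≤deg-g g-roots h)

theorem6p1 : (f g : Poly) →
    ¬ IsZeroPoly f → 1 ℕ.≤ deg f →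
    ¬ IsZeroPoly g → 1 ℕ.≤ deg g →
    SimpleRationalRoots f → SimpleRationalRoots g →
    deg f ℕ.≤ deg g →
    InfManyBoundedDenom (EqSol f g) →
    (φ F G : Poly) (k₁ k₀ l₁ l₀ : ℚ) → k₁ ≢ 0ℚ → l₁ ≢ 0ℚ →
    (∀ x → eval f x ≡ eval φ (eval F (k₁ * x + k₀))) →
    (∀ x → eval g x ≡ eval φ (eval G (l₁ * x + l₀))) →
    StandardPair1or2 F G →
    InfManyBoundedDenom (EqSol F G) →
    Σ ℚ λ a → Σ ℚ λ b → Σ ℚ λ c → Σ ℚ λ d → a ≢ 0ℚ × c ≢ 0ℚ ×
      (Case1 (deg f) (deg g) (λ x → eval f (a * x + b)) (λ y → eval g (c * y + d))
       ⊎ Case2 (deg f) (deg g) (λ x → eval f (a * x + b)) (λ y → eval g (c * y + d)))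
theorem6p1 f g _ 1≤deg-f _ 1≤deg-g f-simple g-simple deg-f≤deg-g _
           φ F G k₁ k₀ l₁ l₀ k₁≢0 l₁≢0 f≗ g≗ standard-pair F=G-solutions =
  conclusion (standard-pair-shape standard-pair F≤G)
  where
  open Decomposition f g φ F G k₁ k₀ l₁ l₀ k₁≢0 l₁≢0 f≗ g≗ f-simple g-simple 1≤deg-f 1≤deg-g deg-f≤deg-g
                     F=G-solutions
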